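{- For every integer $n\geq 0$ and every integer $j\geq 1$, $$\sum_{k=0}^{\lfloor n/2\rfloor}\binom{n}{2k}(5F_j^2)^k F_{j(n-2k)}\,B_{2k} = (-1)^{(n-1)j}\frac{n}{L_j^{n-1}}\sum_{k=0}^{n-1}\binom{n-1}{k}(-1)^{kj}F_{j(2k+1)} - \frac{n}{2}F_{j(n-1)}L_j$$ and $$\sum_{k=0}^{\lfloor n/2\rfloor}\binom{n}{2k}(4^k-1)(5F_j^2)^k L_{j(n-2k)}\,B_{2k} = (-1)^{(n-1)j}\frac{n}{L_j^{n-1}}\sum_{k=0}^{n-1}\binom{n-1}{k}(-1)^{kj}L_{j(2k+1)} - \frac{n}{2}L_{j(n-1)}L_j.$$
   Context: $B_n$ denotes the $n$-th Bernoulli number, defined by $\sum_{n\ge0}B_n\frac{z^n}{n!}=\frac{z}{e^z-1}$. $F_n$ and $L_n$ are the Fibonacci and Lucas numbers: $F_0=0,F_1=1$, $L_0=2,L_1=1$, and $X_n=X_{n-1}+X_{n-2}$ for $n\ge2$. For $n=0$ the terms carrying the factor $n$ are interpreted as $0$ (and the empty sum is $0$). -}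

module Defs where

open import Data.Nat as ℕ using (ℕ; zero; suc; _≤?_; NonZero)
import Data.Nat.Properties as ℕP
open import Data.Nat.Combinatorics using (_C_)
open import Data.Integer using (ℤ; +_)
open import Data.Rational using (ℚ; _/_; _+_; _*_; -_; 0ℚ; 1ℚ)
open import Relation.Nullary using (yes; no)

F : ℕ → ℕ
F 0 = 0
F 1 = 1
F (suc (suc n)) = F (suc n) ℕ.+ F n

L : ℕ → ℕ
L 0 = 2
L 1 = 1
L (suc (suc n)) = L (suc n) ℕ.+ L n

⟦_⟧ : ℕ → ℚ
⟦ n ⟧ = (+ n) / 1

sumBelow : ℕ → (ℕ → ℚ) → ℚ
sumBelow zero f = 0ℚ
sumBelow (suc m) f = sumBelow m f + f m

neg1^ : ℕ → ℚ
neg1^ zero = 1ℚ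
neg1^ (suc m) = - neg1^ m

-- Bernoulli numbers (convention z/(e^z-1), B_1 = -1/2):
-- B_0 = 1, B_m = -(1/(m+1)) Σ_{k<m} C(m+1,k) B_k.
-- bTable n k = B_k for k ≤ n.
nextB : ℕ → (ℕ → ℚ) → ℚ
nextB m t = - (((+ 1) / suc m) * sumBelow m (λ k → ⟦ suc m C k ⟧ * t k))

bTable : ℕ → ℕ → ℚ
bTable zero _ = 1ℚ
bTable (suc n) k with k ≤? n
... | yes _ = bTable n k
... | no _ = nextB (suc n) (bTable n)

B : ℕ → ℚ
B n = bTable n n

L-pos : ∀ j → 1 ℕ.≤ L j
L-pos 0 = ℕ.s≤s ℕ.z≤n
L-pos 1 = ℕ.s≤s ℕ.z≤n
L-pos (suc (suc j)) = ℕP.≤-trans (L-pos (suc j)) (ℕP.m≤m+n (L (suc j)) (L j))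

L^-nonZero : ∀ j m → NonZero (L j ℕ.^ m)
L^-nonZero j m = ℕ.>-nonZero (ℕP.m^n>0 (L j) {{ℕ.>-nonZero (L-pos j)}} m)

_/L[_]^_ : ℕ → ℕ → ℕ → ℚ
n /L[ j ]^ m = (+ n) / (L j ℕ.^ m)
  where instance _ = L^-nonZero j m

{-# OPTIONS --safe #-}
-- Work in ℚ(√5) with a = φʲ, b = ψʲ, so that a - b = √5 Fⱼ, a + b = Lⱼ and ab = (-1)ʲ.
-- Since the Bernoulli numbers have exponential generating function z/(eᶻ - 1),
-- B(dz)·(e^{az} - e^{bz}) = dz·e^{bz} for d = a - b; combining this with the same identity for
-- a and b exchanged cancels the odd Bernoulli numbers, and reading off the coefficient of zⁿ/n! gives
-- the Fibonacci identity. The Lucas identity is the same argument for (1 - 2ᵏ) Bₖ, whose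
-- generating function z/(eᶻ + 1) follows from the Bernoulli one by doubling z. On the right,
-- 1 + ab·a² = ab·a(a + b) turns the binomial sums into (ab)ⁿ⁻¹ Lⱼⁿ⁻¹ aⁿ and its b-analogue,
-- and both sides reduce to the same closed form in a and b.
module Submission where

open import Defs
open import Level using (0ℓ)
open import Function using (_∘_)
open import Data.Empty using (⊥-elim)
open import Data.Maybe using (Maybe; just; nothing)
open import Data.Product using (_×_; _,_)
open import Data.Sum using (_⊎_; inj₁; inj₂)
open import Data.Fin using (Fin; toℕ)
open import Data.Nat as ℕ using (ℕ; zero; suc; _<_; _≤_; _∸_; _/_; _!; s≤s; z≤n; NonZero)
import Data.Nat.Properties as ℕP
open import Data.Nat.Properties using (_!≢0; _!*_!≢0)
import Data.Nat.DivMod as DivMod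
open import Data.Nat.Combinatorics using (_C_; nCk≡nC[n∸k]; nC1≡n; nCk≡n!/k![n-k]!; k![n∸k]!∣n!)
import Data.Nat.Tactic.RingSolver as ℕ-Solver
open import Data.Integer as ℤ using (+_)
import Data.Integer.Properties as ℤP
import Data.Integer.Tactic.RingSolver as ℤ-Solver
open import Data.Rational using (ℚ; _+_; _*_; _-_)
open import Data.Rational as ℚ using (0ℚ; 1ℚ; toℚᵘ)
import Data.Rational.Properties as ℚP
import Data.Rational.Unnormalised as ℚᵘ
import Data.Rational.Unnormalised.Properties as ℚᵘP
open import Relation.Nullary.Decidable using (yes; no; dec⇒maybe)
open import Relation.Binary.PropositionalEquality
open import Relation.Binary.PropositionalEquality using () renaming (trans to infixr 5 _∙_)
import Relation.Binary.Reasoning.Setoid as SetoidReasoning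
open import Algebra.Bundles using (CommutativeRing; CommutativeSemiring)
import Algebra.Definitions.RawMonoid as RawMonoid
import Algebra.Properties.CommutativeSemiring.Binomial as Binomial
import Tactic.RingSolver as Solver
import Tactic.RingSolver.Core.AlmostCommutativeRing as ACR

toℚᵘ-⟦⟧ : ∀ n → toℚᵘ ⟦ n ⟧ ℚᵘ.≃ ℚᵘ.mkℚᵘ (+ n) 0
toℚᵘ-⟦⟧ n = ℚP.toℚᵘ-fromℚᵘ (ℚᵘ.mkℚᵘ (+ n) 0)

⟦⟧-homo-+ : ∀ m n → ⟦ m ℕ.+ n ⟧ ≡ ⟦ m ⟧ ℚ.+ ⟦ n ⟧
⟦⟧-homo-+ m n = ℚP.toℚᵘ-injective (ℚᵘP.≃-trans (toℚᵘ-⟦⟧ (m ℕ.+ n)) (ℚᵘP.≃-trans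
  (ℚᵘ.*≡* (trans (cong (ℤ._* + 1) (ℤP.pos-+ m n)) (integral (+ m) (+ n))))
  (ℚᵘP.≃-sym (ℚᵘP.≃-trans (ℚP.toℚᵘ-homo-+ ⟦ m ⟧ ⟦ n ⟧) (ℚᵘP.+-cong (toℚᵘ-⟦⟧ m) (toℚᵘ-⟦⟧ n))))))
  where
  integral : ∀ a b → (a ℤ.+ b) ℤ.* + 1 ≡ (a ℤ.* + 1 ℤ.+ b ℤ.* + 1) ℤ.* + 1
  integral = ℤ-Solver.solve-∀

⟦⟧-homo-* : ∀ m n → ⟦ m ℕ.* n ⟧ ≡ ⟦ m ⟧ ℚ.* ⟦ n ⟧
⟦⟧-homo-* m n = ℚP.toℚᵘ-injective (ℚᵘP.≃-trans (toℚᵘ-⟦⟧ (m ℕ.* n)) (ℚᵘP.≃-trans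
  (ℚᵘ.*≡* (cong (ℤ._* + 1) (ℤP.pos-* m n)))
  (ℚᵘP.≃-sym (ℚᵘP.≃-trans (ℚP.toℚᵘ-homo-* ⟦ m ⟧ ⟦ n ⟧) (ℚᵘP.*-cong (toℚᵘ-⟦⟧ m) (toℚᵘ-⟦⟧ n))))))

/-*-cancel : ∀ n d .{{_ : NonZero d}} → ((+ n) ℚ./ d) ℚ.* ⟦ d ⟧ ≡ ⟦ n ⟧
/-*-cancel n d@(suc d-1) = ℚP.toℚᵘ-injective (ℚᵘP.≃-trans (ℚP.toℚᵘ-homo-* ((+ n) ℚ./ d) ⟦ d ⟧)
  (ℚᵘP.≃-trans (ℚᵘP.*-cong (ℚP.toℚᵘ-fromℚᵘ (ℚᵘ.mkℚᵘ (+ n) d-1)) (toℚᵘ-⟦⟧ d))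
  (ℚᵘP.≃-trans (ℚᵘ.*≡* (cancel (+ n) (+ d))) (ℚᵘP.≃-sym (toℚᵘ-⟦⟧ n)))))
  where
  cancel : ∀ a b → a ℤ.* b ℤ.* + 1 ≡ a ℤ.* (b ℤ.* + 1)
  cancel = ℤ-Solver.solve-∀

ℚ-ring : ACR.AlmostCommutativeRing 0ℓ 0ℓ
ℚ-ring = ACR.fromCommutativeRing ℚP.+-*-commutativeRing (λ x → dec⇒maybe (0ℚ ℚP.≟ x))

infix 5 _+√5·_
record ℚ√5 : Set where
  no-eta-equality
  pattern
  constructor _+√5·_
  field
    re im : ℚ
open ℚ√5 public

infixl 6 _⊕_ _⊖_
infixl 7 _⊗_
infix 8 ⊝_

_⊕_ : ℚ√5 → ℚ√5 → ℚ√5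
(a +√5· b) ⊕ (c +√5· d) = (a ℚ.+ c) +√5· (b ℚ.+ d)

_⊗_ : ℚ√5 → ℚ√5 → ℚ√5
(a +√5· b) ⊗ (c +√5· d) = (a ℚ.* c ℚ.+ ⟦ 5 ⟧ ℚ.* (b ℚ.* d)) +√5· (a ℚ.* d ℚ.+ b ℚ.* c)

⊝_ : ℚ√5 → ℚ√5
⊝ (a +√5· b) = ℚ.- a +√5· ℚ.- b

_⊖_ : ℚ√5 → ℚ√5 → ℚ√5
x ⊖ y = x ⊕ ⊝ y

0√5 1√5 √5 : ℚ√5
0√5 = 0ℚ +√5· 0ℚ
1√5 = 1ℚ +√5· 0ℚ
√5 = 0ℚ +√5· 1ℚ

private
  module Laws where
    +√5·-cong : ∀ {a b c d} → a ≡ c → b ≡ d → a +√5· b ≡ c +√5· d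
    +√5·-cong = cong₂ _+√5·_

    ⊕-assoc : ∀ x y z → (x ⊕ y) ⊕ z ≡ x ⊕ (y ⊕ z)
    ⊕-assoc (a +√5· b) (c +√5· d) (e +√5· f) = +√5·-cong (ℚP.+-assoc a c e) (ℚP.+-assoc b d f)

    ⊕-comm : ∀ x y → x ⊕ y ≡ y ⊕ x
    ⊕-comm (a +√5· b) (c +√5· d) = +√5·-cong (ℚP.+-comm a c) (ℚP.+-comm b d)

    ⊕-identityˡ : ∀ x → 0√5 ⊕ x ≡ x
    ⊕-identityˡ (a +√5· b) = +√5·-cong (ℚP.+-identityˡ a) (ℚP.+-identityˡ b)

    ⊕-identityʳ : ∀ x → x ⊕ 0√5 ≡ x
    ⊕-identityʳ (a +√5· b) = +√5·-cong (ℚP.+-identityʳ a) (ℚP.+-identityʳ b)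

    ⊝-inverseˡ : ∀ x → ⊝ x ⊕ x ≡ 0√5
    ⊝-inverseˡ (a +√5· b) = +√5·-cong (ℚP.+-inverseˡ a) (ℚP.+-inverseˡ b)

    ⊝-inverseʳ : ∀ x → x ⊕ ⊝ x ≡ 0√5
    ⊝-inverseʳ (a +√5· b) = +√5·-cong (ℚP.+-inverseʳ a) (ℚP.+-inverseʳ b)

    ⊗-assoc : ∀ x y z → (x ⊗ y) ⊗ z ≡ x ⊗ (y ⊗ z)
    ⊗-assoc (a +√5· b) (c +√5· d) (e +√5· f) = +√5·-cong (re-assoc a b c d e f ⟦ 5 ⟧) (im-assoc a b c d e f ⟦ 5 ⟧)
      where
      re-assoc : ∀ a b c d e f v → (a ℚ.* c ℚ.+ v ℚ.* (b ℚ.* d)) ℚ.* e ℚ.+ v ℚ.* ((a ℚ.* d ℚ.+ b ℚ.* c) ℚ.* f)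
                                 ≡ a ℚ.* (c ℚ.* e ℚ.+ v ℚ.* (d ℚ.* f)) ℚ.+ v ℚ.* (b ℚ.* (c ℚ.* f ℚ.+ d ℚ.* e))
      re-assoc = Solver.solve-∀ ℚ-ring
      im-assoc : ∀ a b c d e f v → (a ℚ.* c ℚ.+ v ℚ.* (b ℚ.* d)) ℚ.* f ℚ.+ (a ℚ.* d ℚ.+ b ℚ.* c) ℚ.* e
                                 ≡ a ℚ.* (c ℚ.* f ℚ.+ d ℚ.* e) ℚ.+ b ℚ.* (c ℚ.* e ℚ.+ v ℚ.* (d ℚ.* f))
      im-assoc = Solver.solve-∀ ℚ-ring

    ⊗-comm : ∀ x y → x ⊗ y ≡ y ⊗ x
    ⊗-comm (a +√5· b) (c +√5· d) = +√5·-cong (re-comm a b c d ⟦ 5 ⟧) (im-comm a b c d)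
      where
      re-comm : ∀ a b c d v → a ℚ.* c ℚ.+ v ℚ.* (b ℚ.* d) ≡ c ℚ.* a ℚ.+ v ℚ.* (d ℚ.* b)
      re-comm = Solver.solve-∀ ℚ-ring
      im-comm : ∀ a b c d → a ℚ.* d ℚ.+ b ℚ.* c ≡ c ℚ.* b ℚ.+ d ℚ.* a
      im-comm = Solver.solve-∀ ℚ-ring

    ⊗-identityˡ : ∀ x → 1√5 ⊗ x ≡ x
    ⊗-identityˡ (a +√5· b) = +√5·-cong (re-id a b ⟦ 5 ⟧) (im-id a b)
      where
      re-id : ∀ a b v → 1ℚ ℚ.* a ℚ.+ v ℚ.* (0ℚ ℚ.* b) ≡ a
      re-id = Solver.solve-∀ ℚ-ring
      im-id : ∀ a b → 1ℚ ℚ.* b ℚ.+ 0ℚ ℚ.* a ≡ b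
      im-id = Solver.solve-∀ ℚ-ring

    ⊗-identityʳ : ∀ x → x ⊗ 1√5 ≡ x
    ⊗-identityʳ x = trans (⊗-comm x 1√5) (⊗-identityˡ x)

    ⊗-distribˡ : ∀ x y z → x ⊗ (y ⊕ z) ≡ x ⊗ y ⊕ x ⊗ z
    ⊗-distribˡ (a +√5· b) (c +√5· d) (e +√5· f) = +√5·-cong (re-distrib a b c d e f ⟦ 5 ⟧) (im-distrib a b c d e f)
      where
      re-distrib : ∀ a b c d e f v → a ℚ.* (c ℚ.+ e) ℚ.+ v ℚ.* (b ℚ.* (d ℚ.+ f))
                                   ≡ (a ℚ.* c ℚ.+ v ℚ.* (b ℚ.* d)) ℚ.+ (a ℚ.* e ℚ.+ v ℚ.* (b ℚ.* f))
      re-distrib = Solver.solve-∀ ℚ-ring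
      im-distrib : ∀ a b c d e f → a ℚ.* (d ℚ.+ f) ℚ.+ b ℚ.* (c ℚ.+ e) ≡ (a ℚ.* d ℚ.+ b ℚ.* c) ℚ.+ (a ℚ.* f ℚ.+ b ℚ.* e)
      im-distrib = Solver.solve-∀ ℚ-ring

    ⊗-distribʳ : ∀ x y z → (y ⊕ z) ⊗ x ≡ y ⊗ x ⊕ z ⊗ x
    ⊗-distribʳ x y z = trans (⊗-comm (y ⊕ z) x) (trans (⊗-distribˡ x y z) (cong₂ _⊕_ (⊗-comm x y) (⊗-comm x z)))

ℚ√5-commutativeRing : CommutativeRing 0ℓ 0ℓ
ℚ√5-commutativeRing = record
  { Carrier = ℚ√5 ; _≈_ = _≡_ ; _+_ = _⊕_ ; _*_ = _⊗_ ; -_ = ⊝_ ; 0# = 0√5 ; 1# = 1√5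
  ; isCommutativeRing = record
    { isRing = record
      { +-isAbelianGroup = record
        { isGroup = record
          { isMonoid = record
            { isSemigroup = record
              { isMagma = record { isEquivalence = isEquivalence ; ∙-cong = cong₂ _⊕_ }
              ; assoc = ⊕-assoc }
            ; identity = ⊕-identityˡ , ⊕-identityʳ }
          ; inverse = ⊝-inverseˡ , ⊝-inverseʳ
          ; ⁻¹-cong = cong ⊝_ }
        ; comm = ⊕-comm }
      ; *-cong = cong₂ _⊗_
      ; *-assoc = ⊗-assoc
      ; *-identity = ⊗-identityˡ , ⊗-identityʳ
      ; distrib = ⊗-distribˡ , ⊗-distribʳ }
    ; *-comm = ⊗-comm } }
  where open Laws

open CommutativeRing ℚ√5-commutativeRing public
  using ()
  renaming ( +-assoc to ⊕-assoc; +-comm to ⊕-comm; +-identityˡ to ⊕-identityˡ; +-identityʳ to ⊕-identityʳ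
           ; -‿inverseˡ to ⊝-inverseˡ; -‿inverseʳ to ⊝-inverseʳ
           ; *-assoc to ⊗-assoc; *-comm to ⊗-comm; *-identityˡ to ⊗-identityˡ; *-identityʳ to ⊗-identityʳ
           ; distribˡ to ⊗-distribˡ; distribʳ to ⊗-distribʳ; zeroʳ to ⊗-zeroʳ; zeroˡ to ⊗-zeroˡ)

ℚ√5-ring : ACR.AlmostCommutativeRing 0ℓ 0ℓ
ℚ√5-ring = ACR.fromCommutativeRing ℚ√5-commutativeRing isZero
  where
  isZero : ∀ x → Maybe (0√5 ≡ x)
  isZero (a +√5· b) with 0ℚ ℚP.≟ a | 0ℚ ℚP.≟ b
  ... | yes p | yes q = just (cong₂ _+√5·_ p q)
  ... | _ | _ = nothing

open import Algebra.Properties.CommutativeSemiring.Exp (CommutativeRing.commutativeSemiring ℚ√5-commutativeRing)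
  using (_^_; ^-homo-*; ^-assocʳ; ^-distrib-*)

ι : ℚ → ℚ√5
ι q = q +√5· 0ℚ

ι-homo-* : ∀ p q → ι (p ℚ.* q) ≡ ι p ⊗ ι q
ι-homo-* p q = cong₂ _+√5·_ (re-* p q ⟦ 5 ⟧) (im-* p q)
  where
  re-* : ∀ p q v → p ℚ.* q ≡ p ℚ.* q ℚ.+ v ℚ.* (0ℚ ℚ.* 0ℚ)
  re-* = Solver.solve-∀ ℚ-ring
  im-* : ∀ p q → 0ℚ ≡ p ℚ.* 0ℚ ℚ.+ 0ℚ ℚ.* q
  im-* = Solver.solve-∀ ℚ-ring

ιₙ : ℕ → ℚ√5
ιₙ n = ι ⟦ n ⟧

ιₙ-homo-+ : ∀ m n → ιₙ (m ℕ.+ n) ≡ ιₙ m ⊕ ιₙ n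
ιₙ-homo-+ m n = cong ι (⟦⟧-homo-+ m n)

ιₙ-homo-* : ∀ m n → ιₙ (m ℕ.* n) ≡ ιₙ m ⊗ ιₙ n
ιₙ-homo-* m n = trans (cong ι (⟦⟧-homo-* m n)) (ι-homo-* ⟦ m ⟧ ⟦ n ⟧)

ιₙ-homo-^ : ∀ m n → ιₙ (m ℕ.^ n) ≡ ιₙ m ^ n
ιₙ-homo-^ m zero = refl
ιₙ-homo-^ m (suc n) = trans (ιₙ-homo-* m (m ℕ.^ n)) (cong (ιₙ m ⊗_) (ιₙ-homo-^ m n))

Σ< : ℕ → (ℕ → ℚ√5) → ℚ√5
Σ< zero f = 0√5
Σ< (suc m) f = Σ< m f ⊕ f m

infix 5 Σ<
syntax Σ< m (λ k → e) = Σ[ k < m ] e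

ι-sumBelow : ∀ m f → ι (sumBelow m f) ≡ Σ[ k < m ] ι (f k)
ι-sumBelow zero f = refl
ι-sumBelow (suc m) f = cong (_⊕ ι (f m)) (ι-sumBelow m f)

Σ-cong : ∀ m {f g} → (∀ k → k < m → f k ≡ g k) → Σ< m f ≡ Σ< m g
Σ-cong zero f≡g = refl
Σ-cong (suc m) f≡g = cong₂ _⊕_ (Σ-cong m (λ k k<m → f≡g k (ℕP.m<n⇒m<1+n k<m))) (f≡g m (ℕP.n<1+n m))

Σ-zero : ∀ m {f} → (∀ k → k < m → f k ≡ 0√5) → Σ< m f ≡ 0√5
Σ-zero m f≡0 = trans (Σ-cong m f≡0) (Σ-const-zero m)
  where
  Σ-const-zero : ∀ m → Σ[ k < m ] 0√5 ≡ 0√5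
  Σ-const-zero zero = refl
  Σ-const-zero (suc m) = trans (cong (_⊕ 0√5) (Σ-const-zero m)) (⊕-identityʳ 0√5)

Σ-⊕ : ∀ m f g → Σ[ k < m ] (f k ⊕ g k) ≡ Σ< m f ⊕ Σ< m g
Σ-⊕ zero f g = sym (⊕-identityʳ 0√5)
Σ-⊕ (suc m) f g = trans (cong (_⊕ (f m ⊕ g m)) (Σ-⊕ m f g)) (interchange _ _ _ _)
  where
  interchange : ∀ a b c d → (a ⊕ b) ⊕ (c ⊕ d) ≡ (a ⊕ c) ⊕ (b ⊕ d)
  interchange = Solver.solve-∀ ℚ√5-ring

⊗-Σ : ∀ m c f → c ⊗ Σ< m f ≡ Σ[ k < m ] (c ⊗ f k)
⊗-Σ zero c f = ⊗-zeroʳ c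
⊗-Σ (suc m) c f = trans (⊗-distribˡ c _ _) (cong (_⊕ c ⊗ f m) (⊗-Σ m c f))

Σ-⊗ : ∀ m c f → Σ< m f ⊗ c ≡ Σ[ k < m ] (f k ⊗ c)
Σ-⊗ m c f = trans (⊗-comm _ c) (trans (⊗-Σ m c f) (Σ-cong m (λ k _ → ⊗-comm c (f k))))

Σ-first : ∀ m f → Σ< (suc m) f ≡ f 0 ⊕ (Σ[ k < m ] f (suc k))
Σ-first zero f = trans (⊕-identityˡ (f 0)) (sym (⊕-identityʳ (f 0)))
Σ-first (suc m) f = trans (cong (_⊕ f (suc m)) (Σ-first m f)) (⊕-assoc _ _ _)

Σ-reverse : ∀ m f → Σ< m f ≡ Σ[ k < m ] f (m ∸ suc k)
Σ-reverse zero f = refl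
Σ-reverse (suc m) f = begin
  Σ< m f ⊕ f m                             ≡⟨ cong (_⊕ f m) (Σ-reverse m f) ⟩
  (Σ[ k < m ] f (m ∸ suc k)) ⊕ f m         ≡⟨ ⊕-comm _ _ ⟩
  f m ⊕ (Σ[ k < m ] f (m ∸ suc k))         ≡⟨ Σ-first m (λ k → f (m ∸ k)) ⟨
  Σ[ k < suc m ] f (suc m ∸ suc k)         ∎
  where open ≡-Reasoning

Σ-triangle : ∀ m (g : ℕ → ℕ → ℚ√5) →
  Σ[ i < suc m ] Σ[ k < suc i ] g i k ≡ Σ[ k < suc m ] Σ[ l < suc (m ∸ k) ] g (k ℕ.+ l) k
Σ-triangle zero g = refl
Σ-triangle (suc m) g = begin
  (Σ[ i < suc m ] Σ[ k < suc i ] g i k) ⊕ ((Σ[ k < suc m ] g (suc m) k) ⊕ g (suc m) (suc m))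
    ≡⟨ cong (_⊕ ((Σ[ k < suc m ] g (suc m) k) ⊕ g (suc m) (suc m))) (Σ-triangle m g) ⟩
  (Σ[ k < suc m ] Σ[ l < suc (m ∸ k) ] g (k ℕ.+ l) k) ⊕ ((Σ[ k < suc m ] g (suc m) k) ⊕ g (suc m) (suc m))
    ≡⟨ ⊕-assoc _ _ _ ⟨
  ((Σ[ k < suc m ] Σ[ l < suc (m ∸ k) ] g (k ℕ.+ l) k) ⊕ (Σ[ k < suc m ] g (suc m) k)) ⊕ g (suc m) (suc m)
    ≡⟨ cong₂ _⊕_ (trans (sym (Σ-⊕ (suc m) _ _)) (Σ-cong (suc m) (λ k k≤m → sym (lengthen-column k k≤m)))) corner ⟩
  (Σ[ k < suc m ] Σ[ l < suc (suc m ∸ k) ] g (k ℕ.+ l) k) ⊕ (Σ[ l < suc (m ∸ m) ] g (suc m ℕ.+ l) (suc m))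
    ∎
  where
  open ≡-Reasoning
  lengthen-column : ∀ k → k < suc m →
    (Σ[ l < suc (suc m ∸ k) ] g (k ℕ.+ l) k) ≡ (Σ[ l < suc (m ∸ k) ] g (k ℕ.+ l) k) ⊕ g (suc m) k
  lengthen-column k (s≤s k≤m) rewrite ℕP.+-∸-assoc 1 k≤m =
    cong (λ i → (Σ[ l < suc (m ∸ k) ] g (k ℕ.+ l) k) ⊕ g i k) (trans (ℕP.+-suc k (m ∸ k)) (cong suc (ℕP.m+[n∸m]≡n k≤m)))
  corner : g (suc m) (suc m) ≡ Σ[ l < suc (m ∸ m) ] g (suc m ℕ.+ l) (suc m)
  corner rewrite ℕP.n∸n≡0 m | ℕP.+-identityʳ m = sym (⊕-identityˡ _)

half-parity : ∀ n → n ≡ 2 ℕ.* (n / 2) ⊎ n ≡ suc (2 ℕ.* (n / 2))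
half-parity 0 = inj₁ refl
half-parity 1 = inj₂ refl
half-parity (suc (suc n)) rewrite DivMod.m/n≡1+[m∸n]/n {suc (suc n)} {2} (s≤s (s≤s z≤n)) | ℕP.*-suc 2 (n / 2)
  with half-parity n
... | inj₁ n≡2h = inj₁ (cong (suc ∘ suc) n≡2h)
... | inj₂ n≡2h+1 = inj₂ (cong (suc ∘ suc) n≡2h+1)

module _ {f : ℕ → ℚ√5} (odd≡0 : ∀ i → f (suc (2 ℕ.* i)) ≡ 0√5) where
  private
    Σ-to-even : ∀ h → Σ< (suc (2 ℕ.* h)) f ≡ Σ[ i < suc h ] f (2 ℕ.* i)
    Σ-to-odd : ∀ h → Σ< (suc (suc (2 ℕ.* h))) f ≡ Σ[ i < suc h ] f (2 ℕ.* i)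
    Σ-to-even zero = refl
    Σ-to-even (suc h) = trans (cong (λ m → Σ< (suc m) f) (ℕP.*-suc 2 h))
      (cong₂ _⊕_ (Σ-to-odd h) (cong f (sym (ℕP.*-suc 2 h))))
    Σ-to-odd h = trans (cong₂ _⊕_ (Σ-to-even h) (odd≡0 h)) (⊕-identityʳ _)

  Σ-even : ∀ n → Σ< (suc n) f ≡ Σ[ i < n / 2 ℕ.+ 1 ] f (2 ℕ.* i)
  Σ-even n rewrite ℕP.+-comm (n / 2) 1 with half-parity n
  ... | inj₁ n≡2h = trans (cong (λ m → Σ< (suc m) f) n≡2h) (Σ-to-even (n / 2))
  ... | inj₂ n≡2h+1 = trans (cong (λ m → Σ< (suc m) f) n≡2h+1) (Σ-to-odd (n / 2))

ℚ√5-commutativeSemiring : CommutativeSemiring _ _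
ℚ√5-commutativeSemiring = CommutativeRing.commutativeSemiring ℚ√5-commutativeRing

open RawMonoid (CommutativeSemiring.+-rawMonoid ℚ√5-commutativeSemiring) using (sum) renaming (_×_ to _×ₙ_)

×ₙ-as-ιₙ : ∀ n x → n ×ₙ x ≡ ιₙ n ⊗ x
×ₙ-as-ιₙ zero x = sym (⊗-zeroˡ x)
×ₙ-as-ιₙ (suc n) x = begin
  x ⊕ n ×ₙ x           ≡⟨ cong₂ _⊕_ (sym (⊗-identityˡ x)) (×ₙ-as-ιₙ n x) ⟩
  1√5 ⊗ x ⊕ ιₙ n ⊗ x   ≡⟨ ⊗-distribʳ x 1√5 (ιₙ n) ⟨
  (1√5 ⊕ ιₙ n) ⊗ x     ≡⟨ cong (_⊗ x) (ιₙ-homo-+ 1 n) ⟨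
  ιₙ (suc n) ⊗ x       ∎
  where open ≡-Reasoning

Σ-as-sum : ∀ n f → Σ< n f ≡ sum (λ (i : Fin n) → f (toℕ i))
Σ-as-sum zero f = refl
Σ-as-sum (suc n) f = trans (Σ-first n f) (cong (f 0 ⊕_) (Σ-as-sum n (λ k → f (suc k))))

binomial-theorem : ∀ x y n → Σ[ k < suc n ] ιₙ (n C k) ⊗ (x ^ k ⊗ y ^ (n ∸ k)) ≡ (x ⊕ y) ^ n
binomial-theorem x y n = begin
  Σ[ k < suc n ] ιₙ (n C k) ⊗ (x ^ k ⊗ y ^ (n ∸ k))  ≡⟨ Σ-cong (suc n) (λ k _ → ×ₙ-as-ιₙ (n C k) _) ⟨
  Σ[ k < suc n ] (n C k) ×ₙ (x ^ k ⊗ y ^ (n ∸ k))     ≡⟨ Σ-as-sum (suc n) _ ⟩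
  Binomial.binomialExpansion ℚ√5-commutativeSemiring x y n  ≡⟨ Binomial.theorem ℚ√5-commutativeSemiring n x y ⟨
  (x ⊕ y) ^ n ∎
  where open ≡-Reasoning

nCk*[k!*[n∸k]!]≡n! : ∀ {n k} → k ≤ n → (n C k) ℕ.* (k ! ℕ.* (n ∸ k) !) ≡ n !
nCk*[k!*[n∸k]!]≡n! {n} {k} k≤n = trans (cong (ℕ._* (k ! ℕ.* (n ∸ k) !)) (nCk≡n!/k![n-k]! k≤n))
  (DivMod.m/n*n≡m {{k !* (n ∸ k) !≢0}} (k![n∸k]!∣n! k≤n))

[m]C[k+l]*[k+l]Ck≡mCk*[m∸k]Cl : ∀ m k l → k ℕ.+ l ≤ m →
  (m C (k ℕ.+ l)) ℕ.* ((k ℕ.+ l) C k) ≡ (m C k) ℕ.* ((m ∸ k) C l)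
[m]C[k+l]*[k+l]Ck≡mCk*[m∸k]Cl m k l k+l≤m =
  ℕP.*-cancelʳ-≡ _ _ (k ! ℕ.* (l ! ℕ.* (m ∸ (k ℕ.+ l)) !)) {{factorials≢0}} (trans via-[k+l]! (sym via-[m∸k]!))
  where
  open ≡-Reasoning
  factorials≢0 : ℕ.NonZero (k ! ℕ.* (l ! ℕ.* (m ∸ (k ℕ.+ l)) !))
  factorials≢0 = ℕP.m*n≢0 _ _ {{k !≢0}} {{ℕP.m*n≢0 _ _ {{l !≢0}} {{(m ∸ (k ℕ.+ l)) !≢0}}}}
  k≤k+l : k ≤ k ℕ.+ l
  k≤k+l = ℕP.m≤m+n k l
  l≤m∸k : l ≤ m ∸ k
  l≤m∸k = subst (_≤ m ∸ k) (ℕP.m+n∸m≡n k l) (ℕP.∸-monoˡ-≤ k k+l≤m)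
  reassoc : ∀ a b c d e → a ℕ.* b ℕ.* (c ℕ.* (d ℕ.* e)) ≡ a ℕ.* ((b ℕ.* (c ℕ.* d)) ℕ.* e)
  reassoc = ℕ-Solver.solve-∀
  reassoc′ : ∀ a b c d e → a ℕ.* b ℕ.* (c ℕ.* (d ℕ.* e)) ≡ a ℕ.* (c ℕ.* (b ℕ.* (d ℕ.* e)))
  reassoc′ = ℕ-Solver.solve-∀
  via-[k+l]! : (m C (k ℕ.+ l)) ℕ.* ((k ℕ.+ l) C k) ℕ.* (k ! ℕ.* (l ! ℕ.* (m ∸ (k ℕ.+ l)) !)) ≡ m !
  via-[k+l]! = begin
    (m C (k ℕ.+ l)) ℕ.* ((k ℕ.+ l) C k) ℕ.* (k ! ℕ.* (l ! ℕ.* (m ∸ (k ℕ.+ l)) !))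
      ≡⟨ reassoc (m C (k ℕ.+ l)) ((k ℕ.+ l) C k) (k !) (l !) ((m ∸ (k ℕ.+ l)) !) ⟩
    (m C (k ℕ.+ l)) ℕ.* ((((k ℕ.+ l) C k) ℕ.* (k ! ℕ.* l !)) ℕ.* (m ∸ (k ℕ.+ l)) !)
      ≡⟨ cong (λ t → (m C (k ℕ.+ l)) ℕ.* (t ℕ.* (m ∸ (k ℕ.+ l)) !))
              (subst (λ t → ((k ℕ.+ l) C k) ℕ.* (k ! ℕ.* t !) ≡ (k ℕ.+ l) !) (ℕP.m+n∸m≡n k l) (nCk*[k!*[n∸k]!]≡n! k≤k+l)) ⟩
    (m C (k ℕ.+ l)) ℕ.* ((k ℕ.+ l) ! ℕ.* (m ∸ (k ℕ.+ l)) !)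
      ≡⟨ nCk*[k!*[n∸k]!]≡n! k+l≤m ⟩
    m ! ∎
  via-[m∸k]! : (m C k) ℕ.* ((m ∸ k) C l) ℕ.* (k ! ℕ.* (l ! ℕ.* (m ∸ (k ℕ.+ l)) !)) ≡ m !
  via-[m∸k]! = begin
    (m C k) ℕ.* ((m ∸ k) C l) ℕ.* (k ! ℕ.* (l ! ℕ.* (m ∸ (k ℕ.+ l)) !))
      ≡⟨ reassoc′ (m C k) ((m ∸ k) C l) (k !) (l !) ((m ∸ (k ℕ.+ l)) !) ⟩
    (m C k) ℕ.* (k ! ℕ.* (((m ∸ k) C l) ℕ.* (l ! ℕ.* (m ∸ (k ℕ.+ l)) !)))
      ≡⟨ cong (λ t → (m C k) ℕ.* (k ! ℕ.* t))
              (subst (λ t → ((m ∸ k) C l) ℕ.* (l ! ℕ.* t !) ≡ (m ∸ k) !) (ℕP.∸-+-assoc m k l) (nCk*[k!*[n∸k]!]≡n! l≤m∸k)) ⟩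
    (m C k) ℕ.* (k ! ℕ.* (m ∸ k) !)
      ≡⟨ nCk*[k!*[n∸k]!]≡n! (ℕP.≤-trans k≤k+l k+l≤m) ⟩
    m ! ∎

-- A sequence u stands for its exponential generating function Σ u k zᵏ/k!: _⋆_ is the
-- product, 𝟙 is 1, 𝕫 is z, exp x is eˣᶻ and scale y u is u(yz).
Seq : Set
Seq = ℕ → ℚ√5

infixl 7 _⋆_ _·_
infixl 6 _⊞_

_⊞_ : Seq → Seq → Seq
(u ⊞ v) k = u k ⊕ v k

_·_ : ℚ√5 → Seq → Seq
(c · u) k = c ⊗ u k

𝟙 𝕫 : Seq
𝟙 zero = 1√5
𝟙 (suc _) = 0√5
𝕫 1 = 1√5
𝕫 _ = 0√5

exp : ℚ√5 → Seq
exp x k = x ^ k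

_⋆_ : Seq → Seq → Seq
(u ⋆ v) m = Σ[ k < suc m ] ιₙ (m C k) ⊗ (u k ⊗ v (m ∸ k))

module ≗-Reasoning = SetoidReasoning (ℕ →-setoid ℚ√5)

⋆-congˡ : ∀ w {u v} → u ≗ v → w ⋆ u ≗ w ⋆ v
⋆-congˡ w u≗v m = Σ-cong (suc m) (λ k _ → cong (λ x → ιₙ (m C k) ⊗ (w k ⊗ x)) (u≗v (m ∸ k)))

⋆-congʳ : ∀ w {u v} → u ≗ v → u ⋆ w ≗ v ⋆ w
⋆-congʳ w u≗v m = Σ-cong (suc m) (λ k _ → cong (λ x → ιₙ (m C k) ⊗ (x ⊗ w (m ∸ k))) (u≗v k))

⋆-comm : ∀ u v → u ⋆ v ≗ v ⋆ u
⋆-comm u v m = trans (Σ-reverse (suc m) _) (Σ-cong (suc m) reflect)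
  where
  reflect : ∀ k → k < suc m → ιₙ (m C (m ∸ k)) ⊗ (u (m ∸ k) ⊗ v (m ∸ (m ∸ k))) ≡ ιₙ (m C k) ⊗ (v k ⊗ u (m ∸ k))
  reflect k (s≤s k≤m) = cong₂ (λ c j → ιₙ c ⊗ j) (sym (nCk≡nC[n∸k] k≤m))
    (trans (cong (λ i → u (m ∸ k) ⊗ v i) (ℕP.m∸[m∸n]≡n k≤m)) (⊗-comm (u (m ∸ k)) (v k)))

⋆-identityˡ : ∀ u → 𝟙 ⋆ u ≗ u
⋆-identityˡ u m = begin
  (𝟙 ⋆ u) m                                                 ≡⟨ Σ-first m _ ⟩
  ιₙ 1 ⊗ (1√5 ⊗ u m) ⊕ (Σ[ k < m ] ιₙ (m C suc k) ⊗ (0√5 ⊗ u (m ∸ suc k)))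
    ≡⟨ cong (ιₙ 1 ⊗ (1√5 ⊗ u m) ⊕_) (Σ-zero m (λ k _ → annihilate _ _)) ⟩
  ιₙ 1 ⊗ (1√5 ⊗ u m) ⊕ 0√5                                  ≡⟨ unit (u m) ⟩
  u m                                                       ∎
  where
  open ≡-Reasoning
  annihilate : ∀ c x → c ⊗ (0√5 ⊗ x) ≡ 0√5
  annihilate = Solver.solve-∀ ℚ√5-ring
  unit : ∀ x → ιₙ 1 ⊗ (1√5 ⊗ x) ⊕ 0√5 ≡ x
  unit = Solver.solve-∀ ℚ√5-ring

⋆-distribʳ : ∀ w u v → (u ⊞ v) ⋆ w ≗ u ⋆ w ⊞ v ⋆ w
⋆-distribʳ w u v m = trans (Σ-cong (suc m) (λ k _ → distrib _ _ _ _)) (Σ-⊕ (suc m) _ _)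
  where
  distrib : ∀ c a b x → c ⊗ ((a ⊕ b) ⊗ x) ≡ c ⊗ (a ⊗ x) ⊕ c ⊗ (b ⊗ x)
  distrib = Solver.solve-∀ ℚ√5-ring

·-⋆ : ∀ c u v → (c · u) ⋆ v ≗ c · (u ⋆ v)
·-⋆ c u v m = trans (Σ-cong (suc m) (λ k _ → pull _ c _ _)) (sym (⊗-Σ (suc m) c _))
  where
  pull : ∀ a c x y → a ⊗ ((c ⊗ x) ⊗ y) ≡ c ⊗ (a ⊗ (x ⊗ y))
  pull = Solver.solve-∀ ℚ√5-ring

⋆-assoc : ∀ u v w → (u ⋆ v) ⋆ w ≗ u ⋆ (v ⋆ w)
⋆-assoc u v w m = begin
  ((u ⋆ v) ⋆ w) m                                    ≡⟨ Σ-cong (suc m) (λ i _ → expand-left i) ⟩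
  Σ[ i < suc m ] Σ[ k < suc i ] term i k             ≡⟨ Σ-triangle m term ⟩
  Σ[ k < suc m ] Σ[ l < suc (m ∸ k) ] term (k ℕ.+ l) k  ≡⟨ Σ-cong (suc m) expand-right ⟨
  (u ⋆ (v ⋆ w)) m                                    ∎
  where
  open ≡-Reasoning
  term : ℕ → ℕ → ℚ√5
  term i k = ιₙ ((m C i) ℕ.* (i C k)) ⊗ (u k ⊗ v (i ∸ k) ⊗ w (m ∸ i))
  regroupˡ : ∀ a b x y z → a ⊗ ((b ⊗ (x ⊗ y)) ⊗ z) ≡ (a ⊗ b) ⊗ (x ⊗ y ⊗ z)
  regroupˡ = Solver.solve-∀ ℚ√5-ring
  regroupʳ : ∀ a b x y z → a ⊗ (x ⊗ (b ⊗ (y ⊗ z))) ≡ (a ⊗ b) ⊗ (x ⊗ y ⊗ z)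
  regroupʳ = Solver.solve-∀ ℚ√5-ring
  expand-left : ∀ i → ιₙ (m C i) ⊗ ((u ⋆ v) i ⊗ w (m ∸ i)) ≡ Σ[ k < suc i ] term i k
  expand-left i = begin
    ιₙ (m C i) ⊗ ((u ⋆ v) i ⊗ w (m ∸ i))
      ≡⟨ cong (ιₙ (m C i) ⊗_) (Σ-⊗ (suc i) (w (m ∸ i)) _) ⟩
    ιₙ (m C i) ⊗ (Σ[ k < suc i ] ιₙ (i C k) ⊗ (u k ⊗ v (i ∸ k)) ⊗ w (m ∸ i))
      ≡⟨ ⊗-Σ (suc i) (ιₙ (m C i)) _ ⟩
    Σ[ k < suc i ] ιₙ (m C i) ⊗ (ιₙ (i C k) ⊗ (u k ⊗ v (i ∸ k)) ⊗ w (m ∸ i))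
      ≡⟨ Σ-cong (suc i) (λ k _ → trans (regroupˡ _ _ _ _ _) (cong (_⊗ (u k ⊗ v (i ∸ k) ⊗ w (m ∸ i))) (sym (ιₙ-homo-* (m C i) (i C k))))) ⟩
    Σ[ k < suc i ] term i k ∎
  expand-right : ∀ k → k < suc m → ιₙ (m C k) ⊗ (u k ⊗ (v ⋆ w) (m ∸ k)) ≡ Σ[ l < suc (m ∸ k) ] term (k ℕ.+ l) k
  expand-right k (s≤s k≤m) = begin
    ιₙ (m C k) ⊗ (u k ⊗ (v ⋆ w) (m ∸ k))
      ≡⟨ cong (ιₙ (m C k) ⊗_) (⊗-Σ (suc (m ∸ k)) (u k) _) ⟩
    ιₙ (m C k) ⊗ (Σ[ l < suc (m ∸ k) ] u k ⊗ (ιₙ ((m ∸ k) C l) ⊗ (v l ⊗ w (m ∸ k ∸ l))))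
      ≡⟨ ⊗-Σ (suc (m ∸ k)) (ιₙ (m C k)) _ ⟩
    Σ[ l < suc (m ∸ k) ] ιₙ (m C k) ⊗ (u k ⊗ (ιₙ ((m ∸ k) C l) ⊗ (v l ⊗ w (m ∸ k ∸ l))))
      ≡⟨ Σ-cong (suc (m ∸ k)) reindex ⟩
    Σ[ l < suc (m ∸ k) ] term (k ℕ.+ l) k ∎
    where
    reindex : ∀ l → l < suc (m ∸ k) →
      ιₙ (m C k) ⊗ (u k ⊗ (ιₙ ((m ∸ k) C l) ⊗ (v l ⊗ w (m ∸ k ∸ l)))) ≡ term (k ℕ.+ l) k
    reindex l (s≤s l≤m∸k) = begin
      ιₙ (m C k) ⊗ (u k ⊗ (ιₙ ((m ∸ k) C l) ⊗ (v l ⊗ w (m ∸ k ∸ l))))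
        ≡⟨ regroupʳ _ _ _ _ _ ⟩
      (ιₙ (m C k) ⊗ ιₙ ((m ∸ k) C l)) ⊗ (u k ⊗ v l ⊗ w (m ∸ k ∸ l))
        ≡⟨ cong₂ _⊗_ (trans (sym (ιₙ-homo-* (m C k) ((m ∸ k) C l)))
                            (cong ιₙ (sym ([m]C[k+l]*[k+l]Ck≡mCk*[m∸k]Cl m k l k+l≤m))))
                     (cong₂ (λ i j → u k ⊗ v i ⊗ w j) (sym (ℕP.m+n∸m≡n k l)) (ℕP.∸-+-assoc m k l)) ⟩
      term (k ℕ.+ l) k ∎
      where
      k+l≤m : k ℕ.+ l ≤ m
      k+l≤m = subst (k ℕ.+ l ≤_) (ℕP.m+[n∸m]≡n k≤m) (ℕP.+-monoʳ-≤ k l≤m∸k)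

⋆-identityʳ : ∀ u → u ⋆ 𝟙 ≗ u
⋆-identityʳ u m = trans (⋆-comm u 𝟙 m) (⋆-identityˡ u m)

⋆-distribˡ : ∀ w u v → w ⋆ (u ⊞ v) ≗ w ⋆ u ⊞ w ⋆ v
⋆-distribˡ w u v m = trans (⋆-comm w (u ⊞ v) m) (trans (⋆-distribʳ w u v m) (cong₂ _⊕_ (⋆-comm u w m) (⋆-comm v w m)))

⋆-· : ∀ c u v → u ⋆ (c · v) ≗ c · (u ⋆ v)
⋆-· c u v m = trans (⋆-comm u (c · v) m) (trans (·-⋆ c v u m) (cong (c ⊗_) (⋆-comm v u m)))

⋆-⊞·𝟙 : ∀ u w ε → u ⋆ (w ⊞ ε · 𝟙) ≗ u ⋆ w ⊞ ε · u
⋆-⊞·𝟙 u w ε m = trans (⋆-distribˡ u w (ε · 𝟙) m)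
  (cong (λ x → (u ⋆ w) m ⊕ x) (trans (⋆-· ε u 𝟙 m) (cong (ε ⊗_) (⋆-identityʳ u m))))

⊞-congʳ : ∀ w {u v} → u ≗ v → u ⊞ w ≗ v ⊞ w
⊞-congʳ w u≗v k = cong (_⊕ w k) (u≗v k)

·-congˡ : ∀ c {u v} → u ≗ v → c · u ≗ c · v
·-congˡ c u≗v k = cong (c ⊗_) (u≗v k)

exp-homo : ∀ x y → exp x ⋆ exp y ≗ exp (x ⊕ y)
exp-homo x y = binomial-theorem x y

scale : ℚ√5 → Seq → Seq
scale y u k = y ^ k ⊗ u k

scale-congˡ : ∀ y {u v} → u ≗ v → scale y u ≗ scale y v
scale-congˡ y u≗v k = cong (y ^ k ⊗_) (u≗v k)

scale-⋆ : ∀ y u v → scale y (u ⋆ v) ≗ scale y u ⋆ scale y v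
scale-⋆ y u v m = trans (⊗-Σ (suc m) (y ^ m) _) (Σ-cong (suc m) distribute)
  where
  regroup : ∀ p q a b x → (p ⊗ q) ⊗ (a ⊗ (b ⊗ x)) ≡ a ⊗ ((p ⊗ b) ⊗ (q ⊗ x))
  regroup = Solver.solve-∀ ℚ√5-ring
  distribute : ∀ k → k < suc m →
    y ^ m ⊗ (ιₙ (m C k) ⊗ (u k ⊗ v (m ∸ k))) ≡ ιₙ (m C k) ⊗ (y ^ k ⊗ u k ⊗ (y ^ (m ∸ k) ⊗ v (m ∸ k)))
  distribute k (s≤s k≤m) = trans (cong (_⊗ (ιₙ (m C k) ⊗ (u k ⊗ v (m ∸ k))))
    (trans (cong (y ^_) (sym (ℕP.m+[n∸m]≡n k≤m))) (^-homo-* y k (m ∸ k)))) (regroup _ _ _ _ _)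

scale-exp : ∀ y x → scale y (exp x) ≗ exp (y ⊗ x)
scale-exp y x k = sym (^-distrib-* y x k)

scale-⊞ : ∀ y u v → scale y (u ⊞ v) ≗ scale y u ⊞ scale y v
scale-⊞ y u v k = ⊗-distribˡ (y ^ k) (u k) (v k)

scale-· : ∀ y c u → scale y (c · u) ≗ c · scale y u
scale-· y c u k = swap (y ^ k) c (u k)
  where
  swap : ∀ p c x → p ⊗ (c ⊗ x) ≡ c ⊗ (p ⊗ x)
  swap = Solver.solve-∀ ℚ√5-ring

scale-𝟙 : ∀ y → scale y 𝟙 ≗ 𝟙
scale-𝟙 y zero = ⊗-identityˡ 1√5
scale-𝟙 y (suc k) = ⊗-zeroʳ (y ^ suc k)

scale-𝕫 : ∀ y → scale y 𝕫 ≗ y · 𝕫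
scale-𝕫 y 0 = trans (⊗-zeroʳ (y ^ 0)) (sym (⊗-zeroʳ y))
scale-𝕫 y 1 = cong (_⊗ 1√5) (⊗-identityʳ y)
scale-𝕫 y (suc (suc k)) = trans (⊗-zeroʳ (y ^ suc (suc k))) (sym (⊗-zeroʳ y))

𝕫-⋆ : ∀ v n → (𝕫 ⋆ v) n ≡ ιₙ n ⊗ v (n ∸ 1)
𝕫-⋆ v zero = vanish (v 0)
  where
  vanish : ∀ x → 0√5 ⊕ ιₙ 1 ⊗ (0√5 ⊗ x) ≡ 0√5 ⊗ x
  vanish = Solver.solve-∀ ℚ√5-ring
𝕫-⋆ v (suc m) = begin
  (𝕫 ⋆ v) (suc m)
    ≡⟨ trans (Σ-first (suc m) _) (cong (ιₙ 1 ⊗ (0√5 ⊗ v (suc m)) ⊕_) (Σ-first m _)) ⟩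
  ιₙ 1 ⊗ (0√5 ⊗ v (suc m)) ⊕ (ιₙ (suc m C 1) ⊗ (1√5 ⊗ v m)
    ⊕ (Σ[ k < m ] ιₙ (suc m C suc (suc k)) ⊗ (0√5 ⊗ v (m ∸ suc k))))
    ≡⟨ cong₂ (λ c s → ιₙ 1 ⊗ (0√5 ⊗ v (suc m)) ⊕ (ιₙ c ⊗ (1√5 ⊗ v m) ⊕ s))
             (nC1≡n (suc m)) (Σ-zero m (λ k _ → annihilate _ _)) ⟩
  ιₙ 1 ⊗ (0√5 ⊗ v (suc m)) ⊕ (ιₙ (suc m) ⊗ (1√5 ⊗ v m) ⊕ 0√5)
    ≡⟨ simplify _ _ _ _ ⟩
  ιₙ (suc m) ⊗ v m ∎
  where
  open ≡-Reasoning
  annihilate : ∀ c x → c ⊗ (0√5 ⊗ x) ≡ 0√5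
  annihilate = Solver.solve-∀ ℚ√5-ring
  simplify : ∀ a y c x → a ⊗ (0√5 ⊗ y) ⊕ (c ⊗ (1√5 ⊗ x) ⊕ 0√5) ≡ c ⊗ x
  simplify = Solver.solve-∀ ℚ√5-ring

ιₙ-suc-cancel : ∀ m {x y} → ιₙ (suc m) ⊗ x ≡ ιₙ (suc m) ⊗ y → x ≡ y
ιₙ-suc-cancel m {x} {y} eq = begin
  x                                 ≡⟨ unscale x ⟨
  ι [1+m]⁻¹ ⊗ (ιₙ (suc m) ⊗ x)      ≡⟨ cong (ι [1+m]⁻¹ ⊗_) eq ⟩
  ι [1+m]⁻¹ ⊗ (ιₙ (suc m) ⊗ y)      ≡⟨ unscale y ⟩
  y                                 ∎
  where
  open ≡-Reasoning
  [1+m]⁻¹ : ℚ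
  [1+m]⁻¹ = + 1 ℚ./ suc m
  unscale : ∀ z → ι [1+m]⁻¹ ⊗ (ιₙ (suc m) ⊗ z) ≡ z
  unscale z = begin
    ι [1+m]⁻¹ ⊗ (ιₙ (suc m) ⊗ z)   ≡⟨ ⊗-assoc _ _ z ⟨
    ι [1+m]⁻¹ ⊗ ιₙ (suc m) ⊗ z     ≡⟨ cong (_⊗ z) (sym (ι-homo-* [1+m]⁻¹ ⟦ suc m ⟧)) ⟩
    ι ([1+m]⁻¹ ℚ.* ⟦ suc m ⟧) ⊗ z  ≡⟨ cong (λ q → ι q ⊗ z) (/-*-cancel 1 (suc m)) ⟩
    1√5 ⊗ z                        ≡⟨ ⊗-identityˡ z ⟩
    z                              ∎

⋆𝕫-cancel : ∀ {u v} → u ⋆ 𝕫 ≗ v ⋆ 𝕫 → u ≗ v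
⋆𝕫-cancel {u} {v} eq m = ιₙ-suc-cancel m (begin
  ιₙ (suc m) ⊗ u m       ≡⟨ 𝕫-⋆ u (suc m) ⟨
  (𝕫 ⋆ u) (suc m)        ≡⟨ ⋆-comm 𝕫 u (suc m) ⟩
  (u ⋆ 𝕫) (suc m)        ≡⟨ eq (suc m) ⟩
  (v ⋆ 𝕫) (suc m)        ≡⟨ ⋆-comm v 𝕫 (suc m) ⟩
  (𝕫 ⋆ v) (suc m)        ≡⟨ 𝕫-⋆ v (suc m) ⟩
  ιₙ (suc m) ⊗ v m       ∎)
  where open ≡-Reasoning

B-suc≡nextB : ∀ n → B (suc n) ≡ nextB (suc n) (bTable n)
B-suc≡nextB n with suc n ℕ.≤? n
... | yes 1+n≤n = ⊥-elim (ℕP.1+n≰n 1+n≤n)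
... | no _ = refl

bTable-stable : ∀ {n k} → k ≤ n → bTable n k ≡ B k
bTable-stable {zero} z≤n = refl
bTable-stable {suc n} {k} k≤1+n with k ℕ.≤? n
... | yes k≤n = bTable-stable k≤n
... | no k≰n with ℕP.≤-antisym k≤1+n (ℕP.≰⇒> k≰n)
...   | refl = sym (B-suc≡nextB n)

sumBelow-cong : ∀ m {f g} → (∀ k → k < m → f k ≡ g k) → sumBelow m f ≡ sumBelow m g
sumBelow-cong zero f≡g = refl
sumBelow-cong (suc m) f≡g = cong₂ ℚ._+_ (sumBelow-cong m (λ k k<m → f≡g k (ℕP.m<n⇒m<1+n k<m))) (f≡g m (ℕP.n<1+n m))

[1+m]Cm≡1+m : ∀ m → suc m C m ≡ suc m
[1+m]Cm≡1+m m = trans (nCk≡nC[n∸k] (ℕP.n≤1+n m)) (trans (cong (suc m C_) (ℕP.m+n∸n≡m 1 m)) (nC1≡n (suc m)))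

B-recurrence : ∀ n → sumBelow (suc (suc n)) (λ k → ⟦ suc (suc n) C k ⟧ ℚ.* B k) ≡ 0ℚ
B-recurrence n = begin
  S ℚ.+ ⟦ suc (suc n) C suc n ⟧ ℚ.* B (suc n)
    ≡⟨ cong₂ (λ c b → S ℚ.+ ⟦ c ⟧ ℚ.* b) ([1+m]Cm≡1+m (suc n)) (B-suc≡nextB n) ⟩
  S ℚ.+ ⟦ suc (suc n) ⟧ ℚ.* nextB (suc n) (bTable n)
    ≡⟨ cong (λ t → S ℚ.+ ⟦ suc (suc n) ⟧ ℚ.* ℚ.- (r ℚ.* t))
            (sumBelow-cong (suc n) (λ k k≤n → cong (⟦ suc (suc n) C k ⟧ ℚ.*_) (bTable-stable (ℕP.≤-pred k≤n)))) ⟩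
  S ℚ.+ ⟦ suc (suc n) ⟧ ℚ.* ℚ.- (r ℚ.* S)
    ≡⟨ factor S ⟦ suc (suc n) ⟧ r ⟩
  S ℚ.* (1ℚ ℚ.- r ℚ.* ⟦ suc (suc n) ⟧)
    ≡⟨ cong (λ t → S ℚ.* (1ℚ ℚ.- t)) (/-*-cancel 1 (suc (suc n))) ⟩
  S ℚ.* (1ℚ ℚ.- 1ℚ)
    ≡⟨ ℚP.*-zeroʳ S ⟩
  0ℚ ∎
  where
  open ≡-Reasoning
  S : ℚ
  S = sumBelow (suc n) (λ k → ⟦ suc (suc n) C k ⟧ ℚ.* B k)
  r : ℚ
  r = + 1 ℚ./ suc (suc n)
  factor : ∀ S q r → S ℚ.+ q ℚ.* ℚ.- (r ℚ.* S) ≡ S ℚ.* (1ℚ ℚ.- r ℚ.* q)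
  factor = Solver.solve-∀ ℚ-ring

𝔅 : Seq
𝔅 k = ι (B k)

eᶻ+ : ℚ√5 → Seq
eᶻ+ ε = exp 1√5 ⊞ ε · 𝟙

infix 4 _has-EGF-z/[eᶻ+_]
_has-EGF-z/[eᶻ+_] : Seq → ℚ√5 → Set
c has-EGF-z/[eᶻ+ ε ] = c ⋆ eᶻ+ ε ≗ 𝕫

1^n≡1 : ∀ n → 1√5 ^ n ≡ 1√5
1^n≡1 zero = refl
1^n≡1 (suc n) = trans (⊗-identityˡ (1√5 ^ n)) (1^n≡1 n)

eᶻ-1-suc : ∀ k → eᶻ+ (⊝ 1√5) (suc k) ≡ 1√5
eᶻ-1-suc k = trans (cong (λ p → 1√5 ⊗ p ⊕ ⊝ 1√5 ⊗ 0√5) (1^n≡1 k)) (simplify 1√5)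
  where
  simplify : ∀ x → 1√5 ⊗ x ⊕ ⊝ 1√5 ⊗ 0√5 ≡ x
  simplify = Solver.solve-∀ ℚ√5-ring

⋆-eᶻ-1 : ∀ u m → (u ⋆ eᶻ+ (⊝ 1√5)) (suc m) ≡ Σ[ k < suc m ] ιₙ (suc m C k) ⊗ u k
⋆-eᶻ-1 u m = begin
  (Σ[ k < suc m ] ιₙ (suc m C k) ⊗ (u k ⊗ eᶻ+ (⊝ 1√5) (suc m ∸ k)))
    ⊕ ιₙ (suc m C suc m) ⊗ (u (suc m) ⊗ eᶻ+ (⊝ 1√5) (m ∸ m))
    ≡⟨ cong₂ _⊕_ (Σ-cong (suc m) drop-unit) (cong (λ i → ιₙ (suc m C suc m) ⊗ (u (suc m) ⊗ eᶻ+ (⊝ 1√5) i)) (ℕP.n∸n≡0 m)) ⟩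
  (Σ[ k < suc m ] ιₙ (suc m C k) ⊗ u k) ⊕ ιₙ (suc m C suc m) ⊗ (u (suc m) ⊗ eᶻ+ (⊝ 1√5) 0)
    ≡⟨ drop-last _ _ _ ⟩
  Σ[ k < suc m ] ιₙ (suc m C k) ⊗ u k ∎
  where
  open ≡-Reasoning
  drop-last : ∀ s c x → s ⊕ c ⊗ (x ⊗ (1√5 ⊕ ⊝ 1√5 ⊗ 1√5)) ≡ s
  drop-last = Solver.solve-∀ ℚ√5-ring
  drop-unit : ∀ k → k < suc m → ιₙ (suc m C k) ⊗ (u k ⊗ eᶻ+ (⊝ 1√5) (suc m ∸ k)) ≡ ιₙ (suc m C k) ⊗ u k
  drop-unit k (s≤s k≤m) = begin
    ιₙ (suc m C k) ⊗ (u k ⊗ eᶻ+ (⊝ 1√5) (suc m ∸ k))  ≡⟨ cong (λ i → ιₙ (suc m C k) ⊗ (u k ⊗ eᶻ+ (⊝ 1√5) i)) (ℕP.+-∸-assoc 1 k≤m) ⟩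
    ιₙ (suc m C k) ⊗ (u k ⊗ eᶻ+ (⊝ 1√5) (suc (m ∸ k)))  ≡⟨ cong (λ e → ιₙ (suc m C k) ⊗ (u k ⊗ e)) (eᶻ-1-suc (m ∸ k)) ⟩
    ιₙ (suc m C k) ⊗ (u k ⊗ 1√5)                         ≡⟨ cong (ιₙ (suc m C k) ⊗_) (⊗-identityʳ (u k)) ⟩
    ιₙ (suc m C k) ⊗ u k                                 ∎

bernoulli-egf : 𝔅 has-EGF-z/[eᶻ+ ⊝ 1√5 ]
bernoulli-egf 0 = refl
bernoulli-egf 1 = refl
bernoulli-egf (suc (suc n)) = begin
  (𝔅 ⋆ eᶻ+ (⊝ 1√5)) (suc (suc n))                             ≡⟨ ⋆-eᶻ-1 𝔅 (suc n) ⟩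
  Σ[ k < suc (suc n) ] ιₙ (suc (suc n) C k) ⊗ ι (B k)            ≡⟨ Σ-cong (suc (suc n)) (λ k _ → ι-homo-* ⟦ suc (suc n) C k ⟧ (B k)) ⟨
  Σ[ k < suc (suc n) ] ι (⟦ suc (suc n) C k ⟧ ℚ.* B k)           ≡⟨ ι-sumBelow (suc (suc n)) _ ⟨
  ι (sumBelow (suc (suc n)) (λ k → ⟦ suc (suc n) C k ⟧ ℚ.* B k)) ≡⟨ cong ι (B-recurrence n) ⟩
  0√5                                                            ∎
  where open ≡-Reasoning

-- Multiplying by 𝔅 turns eᶻ - 1 into z, and multiplication by z is injective.
⋆-eᶻ-1-cancel : ∀ {u v} → u ⋆ eᶻ+ (⊝ 1√5) ≗ v ⋆ eᶻ+ (⊝ 1√5) → u ≗ v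
⋆-eᶻ-1-cancel {u} {v} eq = ⋆𝕫-cancel (begin
  u ⋆ 𝕫                          ≈⟨ ⋆-congˡ u (λ k → sym (bernoulli-egf k)) ⟩
  u ⋆ (𝔅 ⋆ eᶻ+ (⊝ 1√5))          ≈⟨ ⋆-congˡ u (⋆-comm 𝔅 _) ⟩
  u ⋆ (eᶻ+ (⊝ 1√5) ⋆ 𝔅)          ≈⟨ ⋆-assoc u _ 𝔅 ⟨
  u ⋆ eᶻ+ (⊝ 1√5) ⋆ 𝔅            ≈⟨ ⋆-congʳ 𝔅 eq ⟩
  v ⋆ eᶻ+ (⊝ 1√5) ⋆ 𝔅            ≈⟨ ⋆-assoc v _ 𝔅 ⟩
  v ⋆ (eᶻ+ (⊝ 1√5) ⋆ 𝔅)          ≈⟨ ⋆-congˡ v (⋆-comm _ 𝔅) ⟩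
  v ⋆ (𝔅 ⋆ eᶻ+ (⊝ 1√5))          ≈⟨ ⋆-congˡ v bernoulli-egf ⟩
  v ⋆ 𝕫                          ∎)
  where open ≗-Reasoning

scale-eᶻ+ : ∀ y ε → scale y (eᶻ+ ε) ≗ exp y ⊞ ε · 𝟙
scale-eᶻ+ y ε k = begin
  scale y (eᶻ+ ε) k                                   ≡⟨ scale-⊞ y (exp 1√5) (ε · 𝟙) k ⟩
  scale y (exp 1√5) k ⊕ scale y (ε · 𝟙) k             ≡⟨ cong₂ _⊕_ (scale-exp y 1√5 k) (scale-· y ε 𝟙 k) ⟩
  (y ⊗ 1√5) ^ k ⊕ ε ⊗ scale y 𝟙 k                     ≡⟨ cong₂ (λ x o → x ^ k ⊕ ε ⊗ o) (⊗-identityʳ y) (scale-𝟙 y k) ⟩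
  y ^ k ⊕ ε ⊗ 𝟙 k                                     ∎
  where open ≡-Reasoning

two : ℚ√5
two = 1√5 ⊕ 1√5

eᶻ+1⋆eᶻ-1 : eᶻ+ 1√5 ⋆ eᶻ+ (⊝ 1√5) ≗ scale two (eᶻ+ (⊝ 1√5))
eᶻ+1⋆eᶻ-1 = begin
  eᶻ+ 1√5 ⋆ eᶻ+ (⊝ 1√5)                                  ≈⟨ ⋆-⊞·𝟙 (eᶻ+ 1√5) (exp 1√5) (⊝ 1√5) ⟩
  eᶻ+ 1√5 ⋆ exp 1√5 ⊞ ⊝ 1√5 · eᶻ+ 1√5                    ≈⟨ ⊞-congʳ (⊝ 1√5 · eᶻ+ 1√5) (⋆-comm (eᶻ+ 1√5) (exp 1√5)) ⟩
  exp 1√5 ⋆ eᶻ+ 1√5 ⊞ ⊝ 1√5 · eᶻ+ 1√5                    ≈⟨ ⊞-congʳ (⊝ 1√5 · eᶻ+ 1√5) (⋆-⊞·𝟙 (exp 1√5) (exp 1√5) 1√5) ⟩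
  (exp 1√5 ⋆ exp 1√5 ⊞ 1√5 · exp 1√5) ⊞ ⊝ 1√5 · eᶻ+ 1√5
    ≈⟨ ⊞-congʳ (⊝ 1√5 · eᶻ+ 1√5) (⊞-congʳ (1√5 · exp 1√5) (exp-homo 1√5 1√5)) ⟩
  (exp two ⊞ 1√5 · exp 1√5) ⊞ ⊝ 1√5 · eᶻ+ 1√5            ≈⟨ (λ k → cancel (exp two k) (exp 1√5 k) (𝟙 k)) ⟩
  exp two ⊞ ⊝ 1√5 · 𝟙                                    ≈⟨ scale-eᶻ+ two (⊝ 1√5) ⟨
  scale two (eᶻ+ (⊝ 1√5))                                ∎
  where
  open ≗-Reasoning
  cancel : ∀ p x o → (p ⊕ 1√5 ⊗ x) ⊕ ⊝ 1√5 ⊗ (x ⊕ 1√5 ⊗ o) ≡ p ⊕ ⊝ 1√5 ⊗ o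
  cancel = Solver.solve-∀ ℚ√5-ring

𝔊 : Seq
𝔊 = 𝔅 ⊞ ⊝ 1√5 · scale two 𝔅

genocchi-egf : 𝔊 has-EGF-z/[eᶻ+ 1√5 ]
genocchi-egf = ⋆-eᶻ-1-cancel (begin
  𝔊 ⋆ eᶻ+ 1√5 ⋆ E                                    ≈⟨ ⋆-assoc 𝔊 (eᶻ+ 1√5) E ⟩
  𝔊 ⋆ (eᶻ+ 1√5 ⋆ E)                                  ≈⟨ ⋆-congˡ 𝔊 eᶻ+1⋆eᶻ-1 ⟩
  𝔊 ⋆ scale two E                                    ≈⟨ ⋆-distribʳ (scale two E) 𝔅 _ ⟩
  𝔅 ⋆ scale two E ⊞ (⊝ 1√5 · scale two 𝔅) ⋆ scale two E
    ≈⟨ (λ k → cong₂ _⊕_ (unscaled k) (trans (·-⋆ (⊝ 1√5) (scale two 𝔅) (scale two E) k) (cong (⊝ 1√5 ⊗_) (scaled k)))) ⟩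
  (𝕫 ⋆ exp 1√5 ⊞ 1√5 · 𝕫) ⊞ ⊝ 1√5 · (two · 𝕫)        ≈⟨ (λ k → collect ((𝕫 ⋆ exp 1√5) k) (𝕫 k)) ⟩
  𝕫 ⋆ exp 1√5 ⊞ ⊝ 1√5 · 𝕫                            ≈⟨ ⋆-⊞·𝟙 𝕫 (exp 1√5) (⊝ 1√5) ⟨
  𝕫 ⋆ E                                              ∎)
  where
  open ≗-Reasoning
  E : Seq
  E = eᶻ+ (⊝ 1√5)
  unscaled : 𝔅 ⋆ scale two E ≗ 𝕫 ⋆ exp 1√5 ⊞ 1√5 · 𝕫
  unscaled = begin
    𝔅 ⋆ scale two E            ≈⟨ ⋆-congˡ 𝔅 eᶻ+1⋆eᶻ-1 ⟨
    𝔅 ⋆ (eᶻ+ 1√5 ⋆ E)          ≈⟨ ⋆-congˡ 𝔅 (⋆-comm (eᶻ+ 1√5) E) ⟩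
    𝔅 ⋆ (E ⋆ eᶻ+ 1√5)          ≈⟨ ⋆-assoc 𝔅 E (eᶻ+ 1√5) ⟨
    𝔅 ⋆ E ⋆ eᶻ+ 1√5            ≈⟨ ⋆-congʳ (eᶻ+ 1√5) bernoulli-egf ⟩
    𝕫 ⋆ eᶻ+ 1√5                ≈⟨ ⋆-⊞·𝟙 𝕫 (exp 1√5) 1√5 ⟩
    𝕫 ⋆ exp 1√5 ⊞ 1√5 · 𝕫      ∎
  scaled : scale two 𝔅 ⋆ scale two E ≗ two · 𝕫
  scaled = begin
    scale two 𝔅 ⋆ scale two E  ≈⟨ scale-⋆ two 𝔅 E ⟨
    scale two (𝔅 ⋆ E)          ≈⟨ scale-congˡ two bernoulli-egf ⟩
    scale two 𝕫                ≈⟨ scale-𝕫 two ⟩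
    two · 𝕫                    ∎
  collect : ∀ p z → (p ⊕ 1√5 ⊗ z) ⊕ ⊝ 1√5 ⊗ (two ⊗ z) ≡ p ⊕ ⊝ 1√5 ⊗ z
  collect = Solver.solve-∀ ℚ√5-ring

appell : ∀ {c ε} → c has-EGF-z/[eᶻ+ ε ] → ∀ a b →
  scale (a ⊖ b) c ⋆ (exp a ⊞ ε · exp b) ≗ (a ⊖ b) · (𝕫 ⋆ exp b)
appell {c} {ε} c-egf a b = begin
  scale d c ⋆ (exp a ⊞ ε · exp b)              ≈⟨ ⋆-congˡ (scale d c) factor-exp-b ⟩
  scale d c ⋆ (exp b ⋆ scale d (eᶻ+ ε))        ≈⟨ ⋆-assoc (scale d c) (exp b) (scale d (eᶻ+ ε)) ⟨
  scale d c ⋆ exp b ⋆ scale d (eᶻ+ ε)          ≈⟨ ⋆-congʳ (scale d (eᶻ+ ε)) (⋆-comm (scale d c) (exp b)) ⟩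
  exp b ⋆ scale d c ⋆ scale d (eᶻ+ ε)          ≈⟨ ⋆-assoc (exp b) (scale d c) (scale d (eᶻ+ ε)) ⟩
  exp b ⋆ (scale d c ⋆ scale d (eᶻ+ ε))        ≈⟨ ⋆-congˡ (exp b) (scale-⋆ d c (eᶻ+ ε)) ⟨
  exp b ⋆ scale d (c ⋆ eᶻ+ ε)                  ≈⟨ ⋆-congˡ (exp b) (scale-congˡ d c-egf) ⟩
  exp b ⋆ scale d 𝕫                            ≈⟨ ⋆-congˡ (exp b) (scale-𝕫 d) ⟩
  exp b ⋆ (d · 𝕫)                              ≈⟨ ⋆-· d (exp b) 𝕫 ⟩
  d · (exp b ⋆ 𝕫)                              ≈⟨ ·-congˡ d (⋆-comm (exp b) 𝕫) ⟩
  d · (𝕫 ⋆ exp b)                              ∎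
  where
  open ≗-Reasoning
  d : ℚ√5
  d = a ⊖ b
  a≡b⊕d : a ≡ b ⊕ d
  a≡b⊕d = a≡b⊕[a⊖b] a b
    where
    a≡b⊕[a⊖b] : ∀ a b → a ≡ b ⊕ (a ⊖ b)
    a≡b⊕[a⊖b] = Solver.solve-∀ ℚ√5-ring
  factor-exp-b : exp a ⊞ ε · exp b ≗ exp b ⋆ scale d (eᶻ+ ε)
  factor-exp-b = begin
    exp a ⊞ ε · exp b              ≈⟨ (λ k → cong (λ x → x ^ k ⊕ ε ⊗ b ^ k) a≡b⊕d) ⟩
    exp (b ⊕ d) ⊞ ε · exp b        ≈⟨ ⊞-congʳ (ε · exp b) (exp-homo b d) ⟨
    exp b ⋆ exp d ⊞ ε · exp b      ≈⟨ ⋆-⊞·𝟙 (exp b) (exp d) ε ⟨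
    exp b ⋆ (exp d ⊞ ε · 𝟙)        ≈⟨ ⋆-congˡ (exp b) (scale-eᶻ+ d ε) ⟨
    exp b ⋆ scale d (eᶻ+ ε)        ∎

scale± : ℚ√5 → Seq → Seq
scale± y c = scale y c ⊞ scale (⊝ y) c

appell-symmetric : ∀ {c ε} → c has-EGF-z/[eᶻ+ ε ] → ε ⊗ ε ≡ 1√5 → ∀ a b n →
  (scale± (a ⊖ b) c ⋆ (exp a ⊞ ε · exp b)) n ≡ ιₙ n ⊗ (a ⊖ b) ⊗ (b ^ (n ∸ 1) ⊖ ε ⊗ a ^ (n ∸ 1))
appell-symmetric {c} {ε} c-egf ε²≡1 a b n = begin
  (scale± (a ⊖ b) c ⋆ W) n                                  ≡⟨ ⋆-distribʳ W _ _ n ⟩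
  (scale (a ⊖ b) c ⋆ W) n ⊕ (scale (⊝ (a ⊖ b)) c ⋆ W) n     ≡⟨ cong₂ _⊕_ (appell c-egf a b n) swapped ⟩
  (a ⊖ b) ⊗ (𝕫 ⋆ exp b) n ⊕ ε ⊗ ((b ⊖ a) ⊗ (𝕫 ⋆ exp a) n)
    ≡⟨ cong₂ (λ x y → (a ⊖ b) ⊗ x ⊕ ε ⊗ ((b ⊖ a) ⊗ y)) (𝕫-⋆ (exp b) n) (𝕫-⋆ (exp a) n) ⟩
  (a ⊖ b) ⊗ (ιₙ n ⊗ b ^ (n ∸ 1)) ⊕ ε ⊗ ((b ⊖ a) ⊗ (ιₙ n ⊗ a ^ (n ∸ 1)))
    ≡⟨ collect a b ε (ιₙ n) (a ^ (n ∸ 1)) (b ^ (n ∸ 1)) ⟩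
  ιₙ n ⊗ (a ⊖ b) ⊗ (b ^ (n ∸ 1) ⊖ ε ⊗ a ^ (n ∸ 1))          ∎
  where
  open ≡-Reasoning
  W W′ : Seq
  W = exp a ⊞ ε · exp b
  W′ = exp b ⊞ ε · exp a
  W≗εW′ : W ≗ ε · W′
  W≗εW′ k = begin
    a ^ k ⊕ ε ⊗ b ^ k                 ≡⟨ cong (_⊕ ε ⊗ b ^ k) (⊗-identityˡ (a ^ k)) ⟨
    1√5 ⊗ a ^ k ⊕ ε ⊗ b ^ k           ≡⟨ cong (λ e → e ⊗ a ^ k ⊕ ε ⊗ b ^ k) ε²≡1 ⟨
    (ε ⊗ ε) ⊗ a ^ k ⊕ ε ⊗ b ^ k       ≡⟨ factor ε (a ^ k) (b ^ k) ⟩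
    ε ⊗ (b ^ k ⊕ ε ⊗ a ^ k)           ∎
    where
    factor : ∀ e x y → (e ⊗ e) ⊗ x ⊕ e ⊗ y ≡ e ⊗ (y ⊕ e ⊗ x)
    factor = Solver.solve-∀ ℚ√5-ring
  ⊝[a⊖b]≡b⊖a : ∀ a b → ⊝ (a ⊖ b) ≡ b ⊖ a
  ⊝[a⊖b]≡b⊖a = Solver.solve-∀ ℚ√5-ring
  swapped : (scale (⊝ (a ⊖ b)) c ⋆ W) n ≡ ε ⊗ ((b ⊖ a) ⊗ (𝕫 ⋆ exp a) n)
  swapped = begin
    (scale (⊝ (a ⊖ b)) c ⋆ W) n     ≡⟨ ⋆-congʳ W (λ k → cong (λ y → y ^ k ⊗ c k) (⊝[a⊖b]≡b⊖a a b)) n ⟩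
    (scale (b ⊖ a) c ⋆ W) n         ≡⟨ ⋆-congˡ (scale (b ⊖ a) c) W≗εW′ n ⟩
    (scale (b ⊖ a) c ⋆ (ε · W′)) n  ≡⟨ ⋆-· ε (scale (b ⊖ a) c) W′ n ⟩
    ε ⊗ (scale (b ⊖ a) c ⋆ W′) n    ≡⟨ cong (ε ⊗_) (appell c-egf b a n) ⟩
    ε ⊗ ((b ⊖ a) ⊗ (𝕫 ⋆ exp a) n)   ∎
  collect : ∀ a b e m x y → (a ⊖ b) ⊗ (m ⊗ y) ⊕ e ⊗ ((b ⊖ a) ⊗ (m ⊗ x)) ≡ m ⊗ (a ⊖ b) ⊗ (y ⊖ e ⊗ x)
  collect = Solver.solve-∀ ℚ√5-ring

⊝-^-even : ∀ y i → (⊝ y) ^ (2 ℕ.* i) ≡ y ^ (2 ℕ.* i)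
⊝-^-even y i = begin
  (⊝ y) ^ (2 ℕ.* i)     ≡⟨ ^-assocʳ (⊝ y) 2 i ⟨
  ((⊝ y) ^ 2) ^ i       ≡⟨ cong (_^ i) (square-neg y) ⟩
  (y ^ 2) ^ i           ≡⟨ ^-assocʳ y 2 i ⟩
  y ^ (2 ℕ.* i)         ∎
  where
  open ≡-Reasoning
  square-neg : ∀ y → ⊝ y ⊗ (⊝ y ⊗ 1√5) ≡ y ⊗ (y ⊗ 1√5)
  square-neg = Solver.solve-∀ ℚ√5-ring

scale±-⋆ : ∀ y c w n → (scale± y c ⋆ w) n ≡
  two ⊗ (Σ[ i < n / 2 ℕ.+ 1 ] ιₙ (n C (2 ℕ.* i)) ⊗ (y ^ (2 ℕ.* i) ⊗ c (2 ℕ.* i) ⊗ w (n ∸ 2 ℕ.* i)))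
scale±-⋆ y c w n = begin
  (scale± y c ⋆ w) n                ≡⟨ Σ-even odd-vanishes n ⟩
  Σ[ i < n / 2 ℕ.+ 1 ] term (2 ℕ.* i)  ≡⟨ Σ-cong (n / 2 ℕ.+ 1) (λ i _ → even-doubles i) ⟩
  Σ[ i < n / 2 ℕ.+ 1 ] two ⊗ (ιₙ (n C (2 ℕ.* i)) ⊗ (y ^ (2 ℕ.* i) ⊗ c (2 ℕ.* i) ⊗ w (n ∸ 2 ℕ.* i)))
                                     ≡⟨ ⊗-Σ (n / 2 ℕ.+ 1) two _ ⟨
  two ⊗ (Σ[ i < n / 2 ℕ.+ 1 ] ιₙ (n C (2 ℕ.* i)) ⊗ (y ^ (2 ℕ.* i) ⊗ c (2 ℕ.* i) ⊗ w (n ∸ 2 ℕ.* i))) ∎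
  where
  open ≡-Reasoning
  term : ℕ → ℚ√5
  term k = ιₙ (n C k) ⊗ ((y ^ k ⊗ c k ⊕ (⊝ y) ^ k ⊗ c k) ⊗ w (n ∸ k))
  odd-vanishes : ∀ i → term (suc (2 ℕ.* i)) ≡ 0√5
  odd-vanishes i = trans (cong (λ p → ιₙ (n C o) ⊗ ((y ^ o ⊗ c o ⊕ ⊝ y ⊗ p ⊗ c o) ⊗ w (n ∸ o))) (⊝-^-even y i))
                         (vanish (ιₙ (n C o)) y (y ^ (2 ℕ.* i)) (c o) (w (n ∸ o)))
    where
    o : ℕ
    o = suc (2 ℕ.* i)
    vanish : ∀ m y p x z → m ⊗ ((y ⊗ p ⊗ x ⊕ ⊝ y ⊗ p ⊗ x) ⊗ z) ≡ 0√5
    vanish = Solver.solve-∀ ℚ√5-ring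
  even-doubles : ∀ i → term (2 ℕ.* i) ≡ two ⊗ (ιₙ (n C (2 ℕ.* i)) ⊗ (y ^ (2 ℕ.* i) ⊗ c (2 ℕ.* i) ⊗ w (n ∸ 2 ℕ.* i)))
  even-doubles i = trans (cong (λ p → ιₙ (n C e) ⊗ ((y ^ e ⊗ c e ⊕ p ⊗ c e) ⊗ w (n ∸ e))) (⊝-^-even y i))
                         (double (ιₙ (n C e)) (y ^ e) (c e) (w (n ∸ e)))
    where
    e : ℕ
    e = 2 ℕ.* i
    double : ∀ m p x z → m ⊗ ((p ⊗ x ⊕ p ⊗ x) ⊗ z) ≡ two ⊗ (m ⊗ (p ⊗ x ⊗ z))
    double = Solver.solve-∀ ℚ√5-ring

φ ψ : ℚ√5
φ = ℚ.½ +√5· ℚ.½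
ψ = ℚ.½ +√5· ℚ.- ℚ.½

FibonacciRecurrence : (ℕ → ℚ√5) → Set
FibonacciRecurrence u = ∀ n → u (suc (suc n)) ≡ u (suc n) ⊕ u n

FibonacciRecurrence-unique : ∀ {u v} → FibonacciRecurrence u → FibonacciRecurrence v →
  u 0 ≡ v 0 → u 1 ≡ v 1 → ∀ n → u n ≡ v n
FibonacciRecurrence-unique u-rec v-rec u0≡v0 u1≡v1 0 = u0≡v0
FibonacciRecurrence-unique u-rec v-rec u0≡v0 u1≡v1 1 = u1≡v1
FibonacciRecurrence-unique u-rec v-rec u0≡v0 u1≡v1 (suc (suc n)) =
  trans (u-rec n) (trans (cong₂ _⊕_ (FibonacciRecurrence-unique u-rec v-rec u0≡v0 u1≡v1 (suc n))
                                    (FibonacciRecurrence-unique u-rec v-rec u0≡v0 u1≡v1 n))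
                         (sym (v-rec n)))

^-fibonacci : ∀ {x} → x ⊗ x ≡ x ⊕ 1√5 → FibonacciRecurrence (x ^_)
^-fibonacci {x} x²≡x+1 n = begin
  x ⊗ (x ⊗ x ^ n)         ≡⟨ ⊗-assoc x x (x ^ n) ⟨
  (x ⊗ x) ⊗ x ^ n         ≡⟨ cong (_⊗ x ^ n) x²≡x+1 ⟩
  (x ⊕ 1√5) ⊗ x ^ n       ≡⟨ ⊗-distribʳ (x ^ n) x 1√5 ⟩
  x ⊗ x ^ n ⊕ 1√5 ⊗ x ^ n ≡⟨ cong (x ⊗ x ^ n ⊕_) (⊗-identityˡ (x ^ n)) ⟩
  x ^ suc n ⊕ x ^ n       ∎
  where open ≡-Reasoning

L-closed : ∀ n → ιₙ (L n) ≡ φ ^ n ⊕ ψ ^ n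
L-closed = FibonacciRecurrence-unique L-rec sum-rec refl refl
  where
  L-rec : FibonacciRecurrence (ιₙ ∘ L)
  L-rec n = ιₙ-homo-+ (L (suc n)) (L n)
  sum-rec : FibonacciRecurrence (λ n → φ ^ n ⊕ ψ ^ n)
  sum-rec n = trans (cong₂ _⊕_ (^-fibonacci refl n) (^-fibonacci refl n)) (interchange _ _ _ _)
    where
    interchange : ∀ a b c d → (a ⊕ b) ⊕ (c ⊕ d) ≡ (a ⊕ c) ⊕ (b ⊕ d)
    interchange = Solver.solve-∀ ℚ√5-ring

F-closed : ∀ n → √5 ⊗ ιₙ (F n) ≡ φ ^ n ⊖ ψ ^ n
F-closed = FibonacciRecurrence-unique F-rec difference-rec refl refl
  where
  F-rec : FibonacciRecurrence (λ n → √5 ⊗ ιₙ (F n))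
  F-rec n = trans (cong (√5 ⊗_) (ιₙ-homo-+ (F (suc n)) (F n))) (⊗-distribˡ √5 (ιₙ (F (suc n))) (ιₙ (F n)))
  difference-rec : FibonacciRecurrence (λ n → φ ^ n ⊖ ψ ^ n)
  difference-rec n = trans (cong₂ _⊖_ (^-fibonacci refl n) (^-fibonacci refl n)) (interchange _ _ _ _)
    where
    interchange : ∀ a b c d → (a ⊕ b) ⊖ (c ⊕ d) ≡ (a ⊖ c) ⊕ (b ⊖ d)
    interchange = Solver.solve-∀ ℚ√5-ring

odd-power-binomial : ∀ a b m → (a ⊗ b) ⊗ (a ⊗ b) ≡ 1√5 →
  Σ[ k < suc m ] ιₙ (m C k) ⊗ ((a ⊗ b) ^ k ⊗ a ^ (2 ℕ.* k ℕ.+ 1)) ≡ (a ⊗ b) ^ m ⊗ (a ⊕ b) ^ m ⊗ a ^ suc m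
odd-power-binomial a b m s²≡1 = begin
  Σ[ k < suc m ] ιₙ (m C k) ⊗ (s ^ k ⊗ a ^ (2 ℕ.* k ℕ.+ 1))
    ≡⟨ Σ-cong (suc m) (λ k _ → split-odd-power k) ⟩
  Σ[ k < suc m ] ιₙ (m C k) ⊗ (x ^ k ⊗ 1√5 ^ (m ∸ k)) ⊗ a
    ≡⟨ Σ-⊗ (suc m) a _ ⟨
  (Σ[ k < suc m ] ιₙ (m C k) ⊗ (x ^ k ⊗ 1√5 ^ (m ∸ k))) ⊗ a
    ≡⟨ cong (_⊗ a) (binomial-theorem x 1√5 m) ⟩
  (x ⊕ 1√5) ^ m ⊗ a
    ≡⟨ cong (λ y → y ^ m ⊗ a) x+1≡sa[a+b] ⟩
  (s ⊗ a ⊗ (a ⊕ b)) ^ m ⊗ a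
    ≡⟨ cong (_⊗ a) (trans (^-distrib-* (s ⊗ a) (a ⊕ b) m) (cong (_⊗ (a ⊕ b) ^ m) (^-distrib-* s a m))) ⟩
  s ^ m ⊗ a ^ m ⊗ (a ⊕ b) ^ m ⊗ a
    ≡⟨ regroup (s ^ m) (a ^ m) ((a ⊕ b) ^ m) a ⟩
  s ^ m ⊗ (a ⊕ b) ^ m ⊗ a ^ suc m ∎
  where
  open ≡-Reasoning
  s x : ℚ√5
  s = a ⊗ b
  x = s ⊗ a ^ 2
  regroup : ∀ p q r a → p ⊗ q ⊗ r ⊗ a ≡ p ⊗ r ⊗ (a ⊗ q)
  regroup = Solver.solve-∀ ℚ√5-ring
  split-odd-power : ∀ k → ιₙ (m C k) ⊗ (s ^ k ⊗ a ^ (2 ℕ.* k ℕ.+ 1)) ≡ ιₙ (m C k) ⊗ (x ^ k ⊗ 1√5 ^ (m ∸ k)) ⊗ a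
  split-odd-power k = begin
    ιₙ (m C k) ⊗ (s ^ k ⊗ a ^ (2 ℕ.* k ℕ.+ 1))
      ≡⟨ cong (λ p → ιₙ (m C k) ⊗ (s ^ k ⊗ p)) (trans (^-homo-* a (2 ℕ.* k) 1) (cong (_⊗ a ^ 1) (sym (^-assocʳ a 2 k)))) ⟩
    ιₙ (m C k) ⊗ (s ^ k ⊗ ((a ^ 2) ^ k ⊗ a ^ 1))
      ≡⟨ regroup′ (ιₙ (m C k)) (s ^ k) ((a ^ 2) ^ k) a ⟩
    ιₙ (m C k) ⊗ (s ^ k ⊗ (a ^ 2) ^ k ⊗ 1√5) ⊗ a
      ≡⟨ cong₂ (λ p q → ιₙ (m C k) ⊗ (p ⊗ q) ⊗ a) (sym (^-distrib-* s (a ^ 2) k)) (sym (1^n≡1 (m ∸ k))) ⟩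
    ιₙ (m C k) ⊗ (x ^ k ⊗ 1√5 ^ (m ∸ k)) ⊗ a ∎
    where
    regroup′ : ∀ c p q a → c ⊗ (p ⊗ (q ⊗ (a ⊗ 1√5))) ≡ c ⊗ (p ⊗ q ⊗ 1√5) ⊗ a
    regroup′ = Solver.solve-∀ ℚ√5-ring
  x+1≡sa[a+b] : x ⊕ 1√5 ≡ s ⊗ a ⊗ (a ⊕ b)
  x+1≡sa[a+b] = trans (cong (x ⊕_) (sym s²≡1)) (factor a b)
    where
    factor : ∀ a b → (a ⊗ b) ⊗ (a ⊗ (a ⊗ 1√5)) ⊕ (a ⊗ b) ⊗ (a ⊗ b) ≡ (a ⊗ b) ⊗ a ⊗ (a ⊕ b)
    factor = Solver.solve-∀ ℚ√5-ring

ι-neg1^ : ∀ t → ι (neg1^ t) ≡ (⊝ 1√5) ^ t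
ι-neg1^ zero = refl
ι-neg1^ (suc t) = trans (cong ⊝_ (ι-neg1^ t)) (neg-as-product ((⊝ 1√5) ^ t))
  where
  neg-as-product : ∀ x → ⊝ x ≡ ⊝ 1√5 ⊗ x
  neg-as-product = Solver.solve-∀ ℚ√5-ring

module _ (j : ℕ) where

  a b : ℚ√5
  a = φ ^ j
  b = ψ ^ j

  √5F[jr] : ∀ r → √5 ⊗ ιₙ (F (j ℕ.* r)) ≡ a ^ r ⊖ b ^ r
  √5F[jr] r = trans (F-closed (j ℕ.* r)) (sym (cong₂ _⊖_ (^-assocʳ φ j r) (^-assocʳ ψ j r)))

  L[jr] : ∀ r → ιₙ (L (j ℕ.* r)) ≡ a ^ r ⊕ b ^ r
  L[jr] r = trans (L-closed (j ℕ.* r)) (sym (cong₂ _⊕_ (^-assocʳ φ j r) (^-assocʳ ψ j r)))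

  [a⊖b]^2i : ∀ i → (a ⊖ b) ^ (2 ℕ.* i) ≡ ιₙ ((5 ℕ.* F j ℕ.^ 2) ℕ.^ i)
  [a⊖b]^2i i = begin
    (a ⊖ b) ^ (2 ℕ.* i)                    ≡⟨ ^-assocʳ (a ⊖ b) 2 i ⟨
    ((a ⊖ b) ^ 2) ^ i                      ≡⟨ cong (λ x → (x ^ 2) ^ i) (F-closed j) ⟨
    ((√5 ⊗ ιₙ (F j)) ^ 2) ^ i              ≡⟨ cong (_^ i) (square √5 (ιₙ (F j))) ⟩
    (ιₙ 5 ⊗ ιₙ (F j) ^ 2) ^ i              ≡⟨ cong (λ x → (ιₙ 5 ⊗ x) ^ i) (ιₙ-homo-^ (F j) 2) ⟨
    (ιₙ 5 ⊗ ιₙ (F j ℕ.^ 2)) ^ i            ≡⟨ cong (_^ i) (ιₙ-homo-* 5 (F j ℕ.^ 2)) ⟨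
    ιₙ (5 ℕ.* F j ℕ.^ 2) ^ i               ≡⟨ ιₙ-homo-^ (5 ℕ.* F j ℕ.^ 2) i ⟨
    ιₙ ((5 ℕ.* F j ℕ.^ 2) ℕ.^ i)           ∎
    where
    open ≡-Reasoning
    square : ∀ r f → (r ⊗ f) ⊗ ((r ⊗ f) ⊗ 1√5) ≡ (r ⊗ r) ⊗ (f ⊗ (f ⊗ 1√5))
    square = Solver.solve-∀ ℚ√5-ring

  ab≡[-1]^j : a ⊗ b ≡ (⊝ 1√5) ^ j
  ab≡[-1]^j = sym (^-distrib-* φ ψ j)

  [ab]²≡1 : (a ⊗ b) ⊗ (a ⊗ b) ≡ 1√5
  [ab]²≡1 = begin
    (a ⊗ b) ⊗ (a ⊗ b)                   ≡⟨ cong (λ x → x ⊗ x) ab≡[-1]^j ⟩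
    (⊝ 1√5) ^ j ⊗ (⊝ 1√5) ^ j           ≡⟨ ^-distrib-* (⊝ 1√5) (⊝ 1√5) j ⟨
    (⊝ 1√5 ⊗ ⊝ 1√5) ^ j                 ≡⟨ 1^n≡1 j ⟩
    1√5                                 ∎
    where open ≡-Reasoning

  ι-neg1^[kj] : ∀ k → ι (neg1^ (k ℕ.* j)) ≡ (a ⊗ b) ^ k
  ι-neg1^[kj] k = begin
    ι (neg1^ (k ℕ.* j))         ≡⟨ ι-neg1^ (k ℕ.* j) ⟩
    (⊝ 1√5) ^ (k ℕ.* j)         ≡⟨ cong ((⊝ 1√5) ^_) (ℕP.*-comm k j) ⟩
    (⊝ 1√5) ^ (j ℕ.* k)         ≡⟨ ^-assocʳ (⊝ 1√5) j k ⟨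
    ((⊝ 1√5) ^ j) ^ k           ≡⟨ cong (_^ k) ab≡[-1]^j ⟨
    (a ⊗ b) ^ k                 ∎
    where open ≡-Reasoning

  -- Twice each side of the Fibonacci identity times √5, and twice each side of the Lucas
  -- identity times -1, equal closedForm (-1) n and closedForm 1 n respectively.
  closedForm : ℚ√5 → ℕ → ℚ√5
  closedForm ε n = ιₙ n ⊗ (a ⊖ b) ⊗ (b ^ (n ∸ 1) ⊖ ε ⊗ a ^ (n ∸ 1))

  evenSum≡closedForm : ∀ {c ε θ} → c has-EGF-z/[eᶻ+ ε ] → ε ⊗ ε ≡ 1√5 → ∀ n (t : ℕ → ℚ) →
    (∀ i → θ ⊗ ι (t i) ≡ ιₙ (n C (2 ℕ.* i)) ⊗ ((a ⊖ b) ^ (2 ℕ.* i) ⊗ c (2 ℕ.* i) ⊗ (a ^ (n ∸ 2 ℕ.* i) ⊕ ε ⊗ b ^ (n ∸ 2 ℕ.* i)))) →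
    two ⊗ (θ ⊗ ι (sumBelow (n / 2 ℕ.+ 1) t)) ≡ closedForm ε n
  evenSum≡closedForm {c} {ε} {θ} c-egf ε²≡1 n t θt≡term = begin
    two ⊗ (θ ⊗ ι (sumBelow (n / 2 ℕ.+ 1) t))     ≡⟨ cong (λ x → two ⊗ (θ ⊗ x)) (ι-sumBelow (n / 2 ℕ.+ 1) t) ⟩
    two ⊗ (θ ⊗ (Σ[ i < n / 2 ℕ.+ 1 ] ι (t i)))   ≡⟨ cong (two ⊗_) (⊗-Σ (n / 2 ℕ.+ 1) θ (ι ∘ t)) ⟩
    two ⊗ (Σ[ i < n / 2 ℕ.+ 1 ] θ ⊗ ι (t i))     ≡⟨ cong (two ⊗_) (Σ-cong (n / 2 ℕ.+ 1) (λ i _ → θt≡term i)) ⟩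
    two ⊗ (Σ[ i < n / 2 ℕ.+ 1 ] ιₙ (n C (2 ℕ.* i)) ⊗ ((a ⊖ b) ^ (2 ℕ.* i) ⊗ c (2 ℕ.* i) ⊗ W (n ∸ 2 ℕ.* i)))
                                                 ≡⟨ scale±-⋆ (a ⊖ b) c W n ⟨
    (scale± (a ⊖ b) c ⋆ W) n                     ≡⟨ appell-symmetric c-egf ε²≡1 a b n ⟩
    closedForm ε n                              ∎
    where
    open ≡-Reasoning
    W : Seq
    W = exp a ⊞ ε · exp b

  binomialSide : (ℕ → ℕ) → ℕ → ℚ
  binomialSide X n = neg1^ ((n ∸ 1) ℕ.* j) ℚ.* (n /L[ j ]^ (n ∸ 1))
      ℚ.* sumBelow n (λ k → ⟦ (n ∸ 1) C k ⟧ ℚ.* neg1^ (k ℕ.* j) ℚ.* ⟦ X (j ℕ.* (2 ℕ.* k ℕ.+ 1)) ⟧)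
    ℚ.- (+ n ℚ./ 2) ℚ.* ⟦ X (j ℕ.* (n ∸ 1)) ⟧ ℚ.* ⟦ L j ⟧

  binomialSide≡closedForm : ∀ X θ ε → (∀ r → θ ⊗ ιₙ (X (j ℕ.* r)) ≡ ⊝ ε ⊗ a ^ r ⊖ b ^ r) →
    ∀ n → two ⊗ (θ ⊗ ι (binomialSide X n)) ≡ closedForm ε n
  binomialSide≡closedForm X θ ε θX≡ zero =
    cong (λ x → two ⊗ (θ ⊗ ι x)) (vanishes (neg1^ (0 ℕ.* j)) (0 /L[ j ]^ 0) ⟦ X (j ℕ.* 0) ⟧ ⟦ L j ⟧)
    ∙ annihilate θ (a ⊖ b) (b ^ 0 ⊖ ε ⊗ a ^ 0)
    where
    vanishes : ∀ s q x l → s ℚ.* q ℚ.* 0ℚ ℚ.- 0ℚ ℚ.* x ℚ.* l ≡ 0ℚ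
    vanishes = Solver.solve-∀ ℚ-ring
    annihilate : ∀ θ x y → two ⊗ (θ ⊗ 0√5) ≡ 0√5 ⊗ x ⊗ y
    annihilate = Solver.solve-∀ ℚ√5-ring
  binomialSide≡closedForm X θ ε θX≡ (suc m) = begin
    two ⊗ (θ ⊗ ι (σ ℚ.* q ℚ.* W ℚ.- h ℚ.* ⟦ X (j ℕ.* m) ⟧ ℚ.* ⟦ L j ⟧))
      ≡⟨ cong (λ x → two ⊗ (θ ⊗ x)) ι-expand ⟩
    two ⊗ (θ ⊗ (ι σ ⊗ ι q ⊗ ι W ⊖ ι h ⊗ ιₙ (X (j ℕ.* m)) ⊗ ιₙ (L j)))
      ≡⟨ regroup θ (ι σ) (ι q) (ι W) (ι h) (ιₙ (X (j ℕ.* m))) (ιₙ (L j)) ⟩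
    ι σ ⊗ ι q ⊗ (two ⊗ (θ ⊗ ι W)) ⊖ (ι h ⊗ two) ⊗ (θ ⊗ ιₙ (X (j ℕ.* m))) ⊗ ιₙ (L j)
      ≡⟨ cong₂ _⊖_ (cong₂ (λ x y → x ⊗ ι q ⊗ (two ⊗ y)) (ι-neg1^[kj] m) θι-odd-sum)
                   (cong₂ (λ x y → x ⊗ y ⊗ ιₙ (L j)) h*2≡1+m (θX≡ m)) ⟩
    S ⊗ ι q ⊗ (two ⊗ (S ⊗ P ⊗ V (suc m))) ⊖ ιₙ (suc m) ⊗ V m ⊗ ιₙ (L j)
      ≡⟨ cong₂ _⊖_ (regroup′ S (ι q) P (V (suc m))) (cong (ιₙ (suc m) ⊗ V m ⊗_) (L-closed j)) ⟩
    (S ⊗ S) ⊗ (ι q ⊗ P) ⊗ (two ⊗ V (suc m)) ⊖ ιₙ (suc m) ⊗ V m ⊗ (a ⊕ b)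
      ≡⟨ cong₂ (λ x y → x ⊗ y ⊗ (two ⊗ V (suc m)) ⊖ ιₙ (suc m) ⊗ V m ⊗ (a ⊕ b)) S²≡1 q*P≡1+m ⟩
    1√5 ⊗ ιₙ (suc m) ⊗ (two ⊗ V (suc m)) ⊖ ιₙ (suc m) ⊗ V m ⊗ (a ⊕ b)
      ≡⟨ telescope a b ε (ιₙ (suc m)) (a ^ m) (b ^ m) ⟩
    closedForm ε (suc m) ∎
    where
    open ≡-Reasoning
    σ q h W : ℚ
    σ = neg1^ (m ℕ.* j)
    q = suc m /L[ j ]^ m
    h = + suc m ℚ./ 2
    W = sumBelow (suc m) (λ k → ⟦ m C k ⟧ ℚ.* neg1^ (k ℕ.* j) ℚ.* ⟦ X (j ℕ.* (2 ℕ.* k ℕ.+ 1)) ⟧)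
    S P : ℚ√5
    S = (a ⊗ b) ^ m
    P = (a ⊕ b) ^ m
    V : ℕ → ℚ√5
    V r = ⊝ ε ⊗ a ^ r ⊖ b ^ r
    ι-expand : ι (σ ℚ.* q ℚ.* W ℚ.- h ℚ.* ⟦ X (j ℕ.* m) ⟧ ℚ.* ⟦ L j ⟧)
             ≡ ι σ ⊗ ι q ⊗ ι W ⊖ ι h ⊗ ιₙ (X (j ℕ.* m)) ⊗ ιₙ (L j)
    ι-expand = cong₂ _⊖_ (ι-homo-* (σ ℚ.* q) W ∙ cong (_⊗ ι W) (ι-homo-* σ q))
                         (ι-homo-* (h ℚ.* ⟦ X (j ℕ.* m) ⟧) ⟦ L j ⟧ ∙ cong (_⊗ ιₙ (L j)) (ι-homo-* h ⟦ X (j ℕ.* m) ⟧))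
    regroup : ∀ θ s q w h x l → two ⊗ (θ ⊗ (s ⊗ q ⊗ w ⊖ h ⊗ x ⊗ l)) ≡ s ⊗ q ⊗ (two ⊗ (θ ⊗ w)) ⊖ (h ⊗ two) ⊗ (θ ⊗ x) ⊗ l
    regroup = Solver.solve-∀ ℚ√5-ring
    regroup′ : ∀ s q p v → s ⊗ q ⊗ (two ⊗ (s ⊗ p ⊗ v)) ≡ (s ⊗ s) ⊗ (q ⊗ p) ⊗ (two ⊗ v)
    regroup′ = Solver.solve-∀ ℚ√5-ring
    telescope : ∀ a b e n x y → 1√5 ⊗ n ⊗ (two ⊗ (⊝ e ⊗ (a ⊗ x) ⊖ b ⊗ y)) ⊖ n ⊗ (⊝ e ⊗ x ⊖ y) ⊗ (a ⊕ b)
                              ≡ n ⊗ (a ⊖ b) ⊗ (y ⊖ e ⊗ x)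
    telescope = Solver.solve-∀ ℚ√5-ring
    S²≡1 : S ⊗ S ≡ 1√5
    S²≡1 = sym (^-distrib-* (a ⊗ b) (a ⊗ b) m) ∙ cong (_^ m) [ab]²≡1 ∙ 1^n≡1 m
    h*2≡1+m : ι h ⊗ two ≡ ιₙ (suc m)
    h*2≡1+m = sym (ι-homo-* h ⟦ 2 ⟧) ∙ cong ι (/-*-cancel (suc m) 2)
    q*P≡1+m : ι q ⊗ P ≡ ιₙ (suc m)
    q*P≡1+m = begin
      ι q ⊗ P                         ≡⟨ cong (λ x → ι q ⊗ x ^ m) (L-closed j) ⟨
      ι q ⊗ ιₙ (L j) ^ m               ≡⟨ cong (ι q ⊗_) (ιₙ-homo-^ (L j) m) ⟨
      ι q ⊗ ιₙ (L j ℕ.^ m)             ≡⟨ ι-homo-* q ⟦ L j ℕ.^ m ⟧ ⟨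
      ι (q ℚ.* ⟦ L j ℕ.^ m ⟧)          ≡⟨ cong ι (/-*-cancel (suc m) (L j ℕ.^ m) {{L^-nonZero j m}}) ⟩
      ιₙ (suc m)                      ∎
    θι-odd-sum : θ ⊗ ι W ≡ S ⊗ P ⊗ V (suc m)
    θι-odd-sum = begin
      θ ⊗ ι W                                         ≡⟨ cong (θ ⊗_) (ι-sumBelow (suc m) _) ⟩
      θ ⊗ (Σ[ k < suc m ] ι (term k))                 ≡⟨ ⊗-Σ (suc m) θ (ι ∘ term) ⟩
      Σ[ k < suc m ] θ ⊗ ι (term k)                   ≡⟨ Σ-cong (suc m) (λ k _ → split k) ⟩
      Σ[ k < suc m ] (⊝ ε ⊗ A k ⊕ ⊝ 1√5 ⊗ B′ k)       ≡⟨ Σ-⊕ (suc m) _ _ ⟩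
      (Σ[ k < suc m ] ⊝ ε ⊗ A k) ⊕ (Σ[ k < suc m ] ⊝ 1√5 ⊗ B′ k)
                                                      ≡⟨ cong₂ _⊕_ (⊗-Σ (suc m) (⊝ ε) A) (⊗-Σ (suc m) (⊝ 1√5) B′) ⟨
      ⊝ ε ⊗ Σ< (suc m) A ⊕ ⊝ 1√5 ⊗ Σ< (suc m) B′       ≡⟨ cong₂ (λ x y → ⊝ ε ⊗ x ⊕ ⊝ 1√5 ⊗ y)
                                                                (odd-power-binomial a b m [ab]²≡1)
                                                                (odd-power-binomial b a m ([ba]²≡1)) ⟩
      ⊝ ε ⊗ (S ⊗ P ⊗ a ^ suc m) ⊕ ⊝ 1√5 ⊗ ((b ⊗ a) ^ m ⊗ (b ⊕ a) ^ m ⊗ b ^ suc m)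
                                                      ≡⟨ cong₂ (λ x y → ⊝ ε ⊗ (S ⊗ P ⊗ a ^ suc m) ⊕ ⊝ 1√5 ⊗ (x ^ m ⊗ y ^ m ⊗ b ^ suc m))
                                                               (⊗-comm b a) (⊕-comm b a) ⟩
      ⊝ ε ⊗ (S ⊗ P ⊗ a ^ suc m) ⊕ ⊝ 1√5 ⊗ (S ⊗ P ⊗ b ^ suc m)
                                                      ≡⟨ factor (⊝ ε) S P (a ^ suc m) (b ^ suc m) ⟩
      S ⊗ P ⊗ V (suc m)                               ∎
      where
      term : ℕ → ℚ
      term k = ⟦ m C k ⟧ ℚ.* neg1^ (k ℕ.* j) ℚ.* ⟦ X (j ℕ.* (2 ℕ.* k ℕ.+ 1)) ⟧
      A B′ : ℕ → ℚ√5
      A k = ιₙ (m C k) ⊗ ((a ⊗ b) ^ k ⊗ a ^ (2 ℕ.* k ℕ.+ 1))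
      B′ k = ιₙ (m C k) ⊗ ((b ⊗ a) ^ k ⊗ b ^ (2 ℕ.* k ℕ.+ 1))
      [ba]²≡1 : (b ⊗ a) ⊗ (b ⊗ a) ≡ 1√5
      [ba]²≡1 = cong (λ x → x ⊗ x) (⊗-comm b a) ∙ [ab]²≡1
      factor : ∀ e s p x y → e ⊗ (s ⊗ p ⊗ x) ⊕ ⊝ 1√5 ⊗ (s ⊗ p ⊗ y) ≡ s ⊗ p ⊗ (e ⊗ x ⊖ y)
      factor = Solver.solve-∀ ℚ√5-ring
      distribute : ∀ c s e x y → c ⊗ s ⊗ (e ⊗ x ⊖ y) ≡ e ⊗ (c ⊗ (s ⊗ x)) ⊕ ⊝ 1√5 ⊗ (c ⊗ (s ⊗ y))
      distribute = Solver.solve-∀ ℚ√5-ring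
      regroup″ : ∀ θ c s x → θ ⊗ (c ⊗ s ⊗ x) ≡ c ⊗ s ⊗ (θ ⊗ x)
      regroup″ = Solver.solve-∀ ℚ√5-ring
      split : ∀ k → θ ⊗ ι (term k) ≡ ⊝ ε ⊗ A k ⊕ ⊝ 1√5 ⊗ B′ k
      split k = begin
        θ ⊗ ι (term k)
          ≡⟨ cong (θ ⊗_) (ι-homo-* (⟦ m C k ⟧ ℚ.* neg1^ (k ℕ.* j)) ⟦ X (j ℕ.* (2 ℕ.* k ℕ.+ 1)) ⟧
                            ∙ cong (_⊗ ιₙ (X (j ℕ.* (2 ℕ.* k ℕ.+ 1)))) (ι-homo-* ⟦ m C k ⟧ (neg1^ (k ℕ.* j)))) ⟩
        θ ⊗ (ιₙ (m C k) ⊗ ι (neg1^ (k ℕ.* j)) ⊗ ιₙ (X (j ℕ.* (2 ℕ.* k ℕ.+ 1))))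
          ≡⟨ regroup″ θ (ιₙ (m C k)) (ι (neg1^ (k ℕ.* j))) (ιₙ (X (j ℕ.* (2 ℕ.* k ℕ.+ 1)))) ⟩
        ιₙ (m C k) ⊗ ι (neg1^ (k ℕ.* j)) ⊗ (θ ⊗ ιₙ (X (j ℕ.* (2 ℕ.* k ℕ.+ 1))))
          ≡⟨ cong₂ (λ x y → ιₙ (m C k) ⊗ x ⊗ y) (ι-neg1^[kj] k) (θX≡ (2 ℕ.* k ℕ.+ 1)) ⟩
        ιₙ (m C k) ⊗ (a ⊗ b) ^ k ⊗ (⊝ ε ⊗ a ^ (2 ℕ.* k ℕ.+ 1) ⊖ b ^ (2 ℕ.* k ℕ.+ 1))
          ≡⟨ distribute (ιₙ (m C k)) ((a ⊗ b) ^ k) (⊝ ε) (a ^ (2 ℕ.* k ℕ.+ 1)) (b ^ (2 ℕ.* k ℕ.+ 1)) ⟩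
        ⊝ ε ⊗ A k ⊕ ⊝ 1√5 ⊗ (ιₙ (m C k) ⊗ ((a ⊗ b) ^ k ⊗ b ^ (2 ℕ.* k ℕ.+ 1)))
          ≡⟨ cong (λ x → ⊝ ε ⊗ A k ⊕ ⊝ 1√5 ⊗ (ιₙ (m C k) ⊗ (x ^ k ⊗ b ^ (2 ℕ.* k ℕ.+ 1)))) (⊗-comm a b) ⟩
        ⊝ ε ⊗ A k ⊕ ⊝ 1√5 ⊗ B′ k ∎

two⊗θ⊗ι-injective : ∀ {θ k x y} → θ ⊗ θ ≡ ιₙ (suc k) → two ⊗ (θ ⊗ ι x) ≡ two ⊗ (θ ⊗ ι y) → x ≡ y
two⊗θ⊗ι-injective {θ} {k} {x} {y} θ²≡1+k eq = cong re (ιₙ-suc-cancel k (begin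
  ιₙ (suc k) ⊗ ι x        ≡⟨ cong (_⊗ ι x) θ²≡1+k ⟨
  θ ⊗ θ ⊗ ι x             ≡⟨ ⊗-assoc θ θ (ι x) ⟩
  θ ⊗ (θ ⊗ ι x)           ≡⟨ cong (θ ⊗_) (ιₙ-suc-cancel 1 eq) ⟩
  θ ⊗ (θ ⊗ ι y)           ≡⟨ ⊗-assoc θ θ (ι y) ⟨
  θ ⊗ θ ⊗ ι y             ≡⟨ cong (_⊗ ι y) θ²≡1+k ⟩
  ιₙ (suc k) ⊗ ι y        ∎))
  where open ≡-Reasoning

ι-homo-*⁴ : ∀ p q r s → ι (p ℚ.* q ℚ.* r ℚ.* s) ≡ ι p ⊗ ι q ⊗ ι r ⊗ ι s
ι-homo-*⁴ p q r s = ι-homo-* (p ℚ.* q ℚ.* r) s ∙ cong (_⊗ ι s) (ι-homo-* (p ℚ.* q) r ∙ cong (_⊗ ι r) (ι-homo-* p q))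

ι-homo-*⁵ : ∀ p q r s t → ι (p ℚ.* q ℚ.* r ℚ.* s ℚ.* t) ≡ ι p ⊗ ι q ⊗ ι r ⊗ ι s ⊗ ι t
ι-homo-*⁵ p q r s t = ι-homo-* (p ℚ.* q ℚ.* r ℚ.* s) t ∙ cong (_⊗ ι t) (ι-homo-*⁴ p q r s)

bernoulliFibonacciSum≡closedForm : ∀ j n →
  two ⊗ (√5 ⊗ ι (sumBelow (n / 2 ℕ.+ 1) (λ k →
    ⟦ n C (2 ℕ.* k) ⟧ ℚ.* ⟦ (5 ℕ.* F j ℕ.^ 2) ℕ.^ k ⟧ ℚ.* ⟦ F (j ℕ.* (n ∸ 2 ℕ.* k)) ⟧ ℚ.* B (2 ℕ.* k))))
    ≡ closedForm j (⊝ 1√5) n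
bernoulliFibonacciSum≡closedForm j n = evenSum≡closedForm j {θ = √5} bernoulli-egf refl n t term
  where
  open ≡-Reasoning
  t : ℕ → ℚ
  t k = ⟦ n C (2 ℕ.* k) ⟧ ℚ.* ⟦ (5 ℕ.* F j ℕ.^ 2) ℕ.^ k ⟧ ℚ.* ⟦ F (j ℕ.* (n ∸ 2 ℕ.* k)) ⟧ ℚ.* B (2 ℕ.* k)
  regroup : ∀ c p f β → √5 ⊗ (c ⊗ p ⊗ f ⊗ β) ≡ c ⊗ (p ⊗ β ⊗ (√5 ⊗ f))
  regroup = Solver.solve-∀ ℚ√5-ring
  difference : ∀ x y → x ⊖ y ≡ x ⊕ ⊝ 1√5 ⊗ y
  difference = Solver.solve-∀ ℚ√5-ring
  term : ∀ i → √5 ⊗ ι (t i)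
    ≡ ιₙ (n C (2 ℕ.* i)) ⊗ ((a j ⊖ b j) ^ (2 ℕ.* i) ⊗ 𝔅 (2 ℕ.* i) ⊗ (a j ^ (n ∸ 2 ℕ.* i) ⊕ ⊝ 1√5 ⊗ b j ^ (n ∸ 2 ℕ.* i)))
  term i = begin
    √5 ⊗ ι (t i)                                      ≡⟨ cong (√5 ⊗_) (ι-homo-*⁴ ⟦ n C 2i ⟧ ⟦ P ℕ.^ i ⟧ ⟦ F (j ℕ.* r) ⟧ (B 2i)) ⟩
    √5 ⊗ (ιₙ (n C 2i) ⊗ ιₙ (P ℕ.^ i) ⊗ ιₙ (F (j ℕ.* r)) ⊗ 𝔅 2i)
                                                      ≡⟨ regroup (ιₙ (n C 2i)) (ιₙ (P ℕ.^ i)) (ιₙ (F (j ℕ.* r))) (𝔅 2i) ⟩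
    ιₙ (n C 2i) ⊗ (ιₙ (P ℕ.^ i) ⊗ 𝔅 2i ⊗ (√5 ⊗ ιₙ (F (j ℕ.* r))))
                                                      ≡⟨ cong₂ (λ p f → ιₙ (n C 2i) ⊗ (p ⊗ 𝔅 2i ⊗ f))
                                                               (sym ([a⊖b]^2i j i)) (√5F[jr] j r ∙ difference (a j ^ r) (b j ^ r)) ⟩
    ιₙ (n C 2i) ⊗ ((a j ⊖ b j) ^ 2i ⊗ 𝔅 2i ⊗ (a j ^ r ⊕ ⊝ 1√5 ⊗ b j ^ r)) ∎
    where
    2i r P : ℕ
    2i = 2 ℕ.* i
    r = n ∸ 2 ℕ.* i
    P = 5 ℕ.* F j ℕ.^ 2

two^2i : ∀ i → two ^ (2 ℕ.* i) ≡ ιₙ (4 ℕ.^ i ∸ 1) ⊕ 1√5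
two^2i i = begin
  two ^ (2 ℕ.* i)                  ≡⟨ ^-assocʳ two 2 i ⟨
  ιₙ 4 ^ i                         ≡⟨ ιₙ-homo-^ 4 i ⟨
  ιₙ (4 ℕ.^ i)                     ≡⟨ cong ιₙ (ℕP.m∸n+n≡m (ℕP.m^n>0 4 i)) ⟨
  ιₙ (4 ℕ.^ i ∸ 1 ℕ.+ 1)           ≡⟨ ιₙ-homo-+ (4 ℕ.^ i ∸ 1) 1 ⟩
  ιₙ (4 ℕ.^ i ∸ 1) ⊕ 1√5           ∎
  where open ≡-Reasoning

bernoulliLucasSum≡closedForm : ∀ j n →
  two ⊗ (⊝ 1√5 ⊗ ι (sumBelow (n / 2 ℕ.+ 1) (λ k →
    ⟦ n C (2 ℕ.* k) ⟧ ℚ.* ⟦ 4 ℕ.^ k ∸ 1 ⟧ ℚ.* ⟦ (5 ℕ.* F j ℕ.^ 2) ℕ.^ k ⟧ ℚ.* ⟦ L (j ℕ.* (n ∸ 2 ℕ.* k)) ⟧ ℚ.* B (2 ℕ.* k))))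
    ≡ closedForm j 1√5 n
bernoulliLucasSum≡closedForm j n = evenSum≡closedForm j {θ = ⊝ 1√5} genocchi-egf refl n t term
  where
  open ≡-Reasoning
  t : ℕ → ℚ
  t k = ⟦ n C (2 ℕ.* k) ⟧ ℚ.* ⟦ 4 ℕ.^ k ∸ 1 ⟧ ℚ.* ⟦ (5 ℕ.* F j ℕ.^ 2) ℕ.^ k ⟧ ℚ.* ⟦ L (j ℕ.* (n ∸ 2 ℕ.* k)) ⟧ ℚ.* B (2 ℕ.* k)
  regroup : ∀ c g p x y β → ⊝ 1√5 ⊗ (c ⊗ g ⊗ p ⊗ (x ⊕ y) ⊗ β) ≡ c ⊗ (p ⊗ (β ⊕ ⊝ 1√5 ⊗ ((g ⊕ 1√5) ⊗ β)) ⊗ (x ⊕ 1√5 ⊗ y))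
  regroup = Solver.solve-∀ ℚ√5-ring
  term : ∀ i → ⊝ 1√5 ⊗ ι (t i)
    ≡ ιₙ (n C (2 ℕ.* i)) ⊗ ((a j ⊖ b j) ^ (2 ℕ.* i) ⊗ 𝔊 (2 ℕ.* i) ⊗ (a j ^ (n ∸ 2 ℕ.* i) ⊕ 1√5 ⊗ b j ^ (n ∸ 2 ℕ.* i)))
  term i = begin
    ⊝ 1√5 ⊗ ι (t i)
      ≡⟨ cong (⊝ 1√5 ⊗_) (ι-homo-*⁵ ⟦ n C 2i ⟧ ⟦ 4 ℕ.^ i ∸ 1 ⟧ ⟦ P ℕ.^ i ⟧ ⟦ L (j ℕ.* r) ⟧ (B 2i)) ⟩
    ⊝ 1√5 ⊗ (ιₙ (n C 2i) ⊗ ιₙ (4 ℕ.^ i ∸ 1) ⊗ ιₙ (P ℕ.^ i) ⊗ ιₙ (L (j ℕ.* r)) ⊗ 𝔅 2i)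
      ≡⟨ cong (λ l → ⊝ 1√5 ⊗ (ιₙ (n C 2i) ⊗ ιₙ (4 ℕ.^ i ∸ 1) ⊗ ιₙ (P ℕ.^ i) ⊗ l ⊗ 𝔅 2i)) (L[jr] j r) ⟩
    ⊝ 1√5 ⊗ (ιₙ (n C 2i) ⊗ ιₙ (4 ℕ.^ i ∸ 1) ⊗ ιₙ (P ℕ.^ i) ⊗ (a j ^ r ⊕ b j ^ r) ⊗ 𝔅 2i)
      ≡⟨ regroup (ιₙ (n C 2i)) (ιₙ (4 ℕ.^ i ∸ 1)) (ιₙ (P ℕ.^ i)) (a j ^ r) (b j ^ r) (𝔅 2i) ⟩
    ιₙ (n C 2i) ⊗ (ιₙ (P ℕ.^ i) ⊗ (𝔅 2i ⊕ ⊝ 1√5 ⊗ ((ιₙ (4 ℕ.^ i ∸ 1) ⊕ 1√5) ⊗ 𝔅 2i)) ⊗ (a j ^ r ⊕ 1√5 ⊗ b j ^ r))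
      ≡⟨ cong₂ (λ p q → ιₙ (n C 2i) ⊗ (p ⊗ (𝔅 2i ⊕ ⊝ 1√5 ⊗ (q ⊗ 𝔅 2i)) ⊗ (a j ^ r ⊕ 1√5 ⊗ b j ^ r)))
               (sym ([a⊖b]^2i j i)) (sym (two^2i i)) ⟩
    ιₙ (n C 2i) ⊗ ((a j ⊖ b j) ^ 2i ⊗ 𝔊 2i ⊗ (a j ^ r ⊕ 1√5 ⊗ b j ^ r)) ∎
    where
    2i r P : ℕ
    2i = 2 ℕ.* i
    r = n ∸ 2 ℕ.* i
    P = 5 ℕ.* F j ℕ.^ 2


corollary12 : (n j : ℕ) → 1 ≤ j →
  (sumBelow (n / 2 ℕ.+ 1) (λ k → ⟦ n C (2 ℕ.* k) ⟧ * ⟦ (5 ℕ.* F j ℕ.^ 2) ℕ.^ k ⟧ * ⟦ F (j ℕ.* (n ∸ 2 ℕ.* k)) ⟧ * B (2 ℕ.* k))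
    ≡ neg1^ ((n ∸ 1) ℕ.* j) * (n /L[ j ]^ (n ∸ 1))
        * sumBelow n (λ k → ⟦ (n ∸ 1) C k ⟧ * neg1^ (k ℕ.* j) * ⟦ F (j ℕ.* (2 ℕ.* k ℕ.+ 1)) ⟧)
      - (+ n Data.Rational./ 2) * ⟦ F (j ℕ.* (n ∸ 1)) ⟧ * ⟦ L j ⟧)
  ×
  (sumBelow (n / 2 ℕ.+ 1) (λ k → ⟦ n C (2 ℕ.* k) ⟧ * ⟦ 4 ℕ.^ k ∸ 1 ⟧ * ⟦ (5 ℕ.* F j ℕ.^ 2) ℕ.^ k ⟧ * ⟦ L (j ℕ.* (n ∸ 2 ℕ.* k)) ⟧ * B (2 ℕ.* k))
    ≡ neg1^ ((n ∸ 1) ℕ.* j) * (n /L[ j ]^ (n ∸ 1))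
        * sumBelow n (λ k → ⟦ (n ∸ 1) C k ⟧ * neg1^ (k ℕ.* j) * ⟦ L (j ℕ.* (2 ℕ.* k ℕ.+ 1)) ⟧)
      - (+ n Data.Rational./ 2) * ⟦ L (j ℕ.* (n ∸ 1)) ⟧ * ⟦ L j ⟧)
corollary12 n j _ =
    two⊗θ⊗ι-injective {θ = √5} {k = 4} refl
      (bernoulliFibonacciSum≡closedForm j n ∙ sym (binomialSide≡closedForm j F √5 (⊝ 1√5) √5F[jr]′ n))
  , two⊗θ⊗ι-injective {θ = ⊝ 1√5} {k = 0} refl
      (bernoulliLucasSum≡closedForm j n ∙ sym (binomialSide≡closedForm j L (⊝ 1√5) 1√5 ⊝L[jr] n))
  where
  √5F[jr]′ : ∀ r → √5 ⊗ ιₙ (F (j ℕ.* r)) ≡ ⊝ ⊝ 1√5 ⊗ a j ^ r ⊖ b j ^ r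
  √5F[jr]′ r = √5F[jr] j r ∙ unit (a j ^ r) (b j ^ r)
    where
    unit : ∀ x y → x ⊖ y ≡ ⊝ ⊝ 1√5 ⊗ x ⊖ y
    unit = Solver.solve-∀ ℚ√5-ring
  ⊝L[jr] : ∀ r → ⊝ 1√5 ⊗ ιₙ (L (j ℕ.* r)) ≡ ⊝ 1√5 ⊗ a j ^ r ⊖ b j ^ r
  ⊝L[jr] r = cong (⊝ 1√5 ⊗_) (L[jr] j r) ∙ distribute (a j ^ r) (b j ^ r)
    where
    distribute : ∀ x y → ⊝ 1√5 ⊗ (x ⊕ y) ≡ ⊝ 1√5 ⊗ x ⊖ y
    distribute = Solver.solve-∀ ℚ√5-ring
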